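{- Let $M=p_1^{n_1}\cdots p_K^{n_K}$ and $A,B\subset\mathbb{Z}_M$ with $A\oplus B=\mathbb{Z}_M$. Let $\Lambda_{ij}=\Lambda(z,M/p_ip_j)$ for some $z\in\mathbb{Z}_M$ and $i,j\in\{1,\dots,K\}$. If $a_0*F_i\subset A$ for some $a_0\in\Sigma_A(\Lambda_{ij})$, then $\Sigma_A(\Lambda_{ij})\subset\Pi(a_0,p_j^{n_j-1})$.
   Context: $A\oplus B=\mathbb{Z}_M$: every element of $\mathbb{Z}_M$ is uniquely $a+b$. $\Lambda(x,D)=\{x'\in\mathbb{Z}_M:D\mid x-x'\}$, $\Pi(x,p^\beta)=\Lambda(x,p^\beta)$. $F_i=\{tM/p_i:0\le t<p_i\}$, $x*F_i=x+F_i$. $\Sigma_A(Z)=\{a\in A:a+b\in Z\text{ for some }b\in B\}$. -}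

module Defs where

open import Data.Nat using (ℕ; NonZero; _*_; _^_; _+_; _<_)
open import Data.Nat.DivMod using (_/_; _mod_)
open import Data.Nat.Primality using (Prime; prime⇒nonZero)
open import Data.Nat.Properties using (m*n≢0)
open import Data.Fin using (Fin; toℕ)
import Data.Fin as Fin
open import Data.Integer using (+_; _-_)
open import Data.Integer.Divisibility using () renaming (_∣_ to _∣ℤ_)
open import Data.Product using (Σ; _×_)
open import Relation.Binary.PropositionalEquality using (_≡_)

primePowerProduct : (K : ℕ) → (Fin K → ℕ) → (Fin K → ℕ) → ℕ
primePowerProduct ℕ.zero    p n = 1
primePowerProduct (ℕ.suc K) p n =
  (p Fin.zero ^ n Fin.zero) * primePowerProduct K (λ k → p (Fin.suc k)) (λ k → n (Fin.suc k))

Subset : ℕ → Set₁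
Subset M = Fin M → Set

addM : {M : ℕ} → .{{NonZero M}} → Fin M → Fin M → Fin M
addM {M} x y = (toℕ x + toℕ y) mod M

DirectSumIsZM : (M : ℕ) → .{{NonZero M}} → Subset M → Subset M → Set
DirectSumIsZM M A B =
  ((x : Fin M) → Σ (Fin M) λ a → Σ (Fin M) λ b → A a × B b × addM a b ≡ x)
  × ((a a' b b' : Fin M) → A a → A a' → B b → B b' →
       addM a b ≡ addM a' b' → (a ≡ a') × (b ≡ b'))

Λ : (M : ℕ) → Fin M → ℕ → Subset M
Λ M x D x' = (+ D) ∣ℤ ((+ toℕ x) - (+ toℕ x'))

Π : (M : ℕ) → Fin M → ℕ → ℕ → Subset M
Π M x p β = Λ M x (p ^ β)

F : (M : ℕ) → .{{NonZero M}} → (p : ℕ) → Prime p → Subset M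
F M p pp y = Σ ℕ λ t → (t < p) × (y ≡ ((t * (M / p)) mod M))
  where instance _ = prime⇒nonZero pp

TranslateSubset : {M : ℕ} → .{{NonZero M}} → Fin M → Subset M → Subset M → Set
TranslateSubset {M} x Fp A = (y : Fin M) → Fp y → A (addM x y)

quot2 : (M p q : ℕ) → Prime p → Prime q → ℕ
quot2 M p q pp pq = M / (p * q)
  where instance
          _ = prime⇒nonZero pp
          _ = prime⇒nonZero pq
          _ = m*n≢0 p q

ΣA : (M : ℕ) → .{{NonZero M}} → Subset M → Subset M → Subset M → Subset M
ΣA M A B Z a = A a × Σ (Fin M) λ b → B b × Z (addM a b)

-- Tijdeman's dilation theorem: if A ⊕ B = ℤ_M and u is coprime to M, then u·A ⊕ B = ℤ_M. For a prime r ∤ M it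
-- follows from the Frobenius congruence (Σ_{a∈A} a)^r ≡ Σ_{a∈A} r·a (mod r) in the group semiring ℕ[ℤ_M].
-- Write D = M/(p_i p_j). As a₀ + b₀ ≡ a + b (mod D), a suitable a' ∈ a₀ * F_i ⊆ A satisfies
-- a - a' ≡ b₀ - b (mod M/p_j). If p_j^{n_j-1} did not divide a - a', there would be a u ≡ 1 modulo every prime
-- factor of M with u(a - a') ≡ b₀ - b (mod M); then u·a + b = u·a' + b₀ in u·A ⊕ B forces a = a', which is
-- absurd. So p_j^{n_j-1} divides a - a', hence also a₀ - a, because a' ≡ a₀ (mod p_j D) and p_j^{n_j-1} ∣ D.

module Submission where

open import Algebra.Bundles using (CommutativeSemiring)
import Algebra.Properties.CommutativeSemiring.Binomial
open import Algebra.Structures.Biased using (IsCommutativeSemiringˡ)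
open import Data.Bool using (if_then_else_)
open import Data.Empty using (⊥; ⊥-elim)
open import Data.Fin as Fin using (Fin; toℕ)
open import Data.Fin.Properties using (toℕ<n; toℕ-fromℕ<; toℕ-injective; toℕ≤pred[n]; toℕ-fromℕ)
open import Data.Integer as ℤ using (ℤ; +_; -[1+_]; 0ℤ; 1ℤ)
open import Data.Integer.DivMod using (_%ℕ_; _/ℕ_; n%ℕd<d; a≡a%ℕn+[a/ℕn]*n)
open import Data.Integer.Divisibility.Signed as ℤ∣ using () renaming (_∣_ to _∣ℤ_)
import Data.Integer.Properties as ℤ
open import Data.Integer.Tactic.RingSolver using (solve-∀)
open import Data.List using (List; []; _∷_; _++_; map; length; allFin; filter)
open import Data.List.Membership.Propositional using (_∈_)
open import Data.List.Membership.Propositional.Properties using (∈-allFin)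
open import Data.List.Properties
  using (map-tabulate; map-cong; map-id; map-∘; length-++; length-map; length-tabulate; ++-assoc; ++-identityʳ)
open import Data.List.Relation.Unary.All using (All; []; _∷_)
open import Data.List.Relation.Unary.Any using (here; there)
open import Data.Nat using (ℕ; zero; suc; NonZero; _+_; _*_; _∸_; _^_; _≤_; _<_; _≥_; z≤n; s≤s; _!)
open import Data.Nat.Combinatorics using (_C_; nCk≡n!/k![n-k]!; k![n∸k]!∣n!; nCn≡1)
open import Data.Nat.Coprimality using (Coprime; coprime-Bézout)
open import Data.Nat.DivMod using (_%_; _/_; _mod_; m%n<n; m≡m%n+[m/n]*n; m*n/n≡m; m/n*n≡m)
open import Data.Nat.Divisibility as ℕ∣
  using (_∣_; divides; *-monoʳ-∣; ∣1⇒≡1; ∣⇒≤; m∣m*n; n∣m*n; ∣m+n∣m⇒∣n; ∣m⇒∣m*n; ∣n⇒∣m*n)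
open import Data.Nat.GCD using (module Bézout)
open import Data.Nat.ListAction using (product)
open import Data.Nat.Primality using (Prime; ¬prime[1]; euclidsLemma; prime⇒irreducible; prime⇒nonZero)
open import Data.Nat.Primality.Factorisation using (factorise; module PrimeFactorisation)
open PrimeFactorisation using (isFactorisation; factorsPrime)
open import Data.Nat.Properties
open import Algebra.Properties.CommutativeSemigroup +-commutativeSemigroup
  using () renaming (interchange to +-interchange)
import Data.Nat.Tactic.RingSolver
open import Data.Product using (Σ; _×_; _,_; proj₁; proj₂)
open import Data.Sum using (inj₁; inj₂)
import Data.Vec.Functional as Vector
open import Function using (_∘_; id)
open import Level using (0ℓ)
open import Relation.Binary.Bundles using (Setoid)
import Relation.Binary.Reasoning.Setoid
open import Relation.Binary.Structures using (IsEquivalence)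
open import Relation.Binary.PropositionalEquality
open import Relation.Nullary using (¬_; yes; no; does)
open import Relation.Nullary.Decidable using (decidable-stable; ¬¬-excluded-middle)
open import Relation.Unary using (Decidable)
open import Defs

variable
  A B : Set
  n p : ℕ

prime∤1 : Prime p → ¬ p ∣ 1
prime∤1 pp p∣1 = ¬prime[1] (subst Prime (∣1⇒≡1 p∣1) pp)

prime∣^⇒∣ : ∀ m k → Prime p → p ∣ m ^ k → p ∣ m
prime∣^⇒∣ m zero    pp p∣1 = ⊥-elim (prime∤1 pp p∣1)
prime∣^⇒∣ m (suc k) pp p∣m^k+1 with euclidsLemma m (m ^ k) pp p∣m^k+1
... | inj₁ p∣m   = p∣m
... | inj₂ p∣m^k = prime∣^⇒∣ m k pp p∣m^k

prime∤! : Prime p → ∀ k → k < p → ¬ p ∣ k !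
prime∤! pp zero    _   p∣1 = prime∤1 pp p∣1
prime∤! pp (suc k) k<p p∣k! with euclidsLemma (suc k) (k !) pp p∣k!
... | inj₁ p∣k+1 = <⇒≱ k<p (∣⇒≤ p∣k+1)
... | inj₂ p∣k!  = prime∤! pp k (<-trans (n<1+n k) k<p) p∣k!

prime∣C : Prime p → ∀ k → 0 < k → k < p → p ∣ p C k
prime∣C {p@(suc p-1)} pp k 0<k k<p with euclidsLemma (p C k) (k ! * (p ∸ k) !) pp p∣C*k![p-k]!
  where
  instance _ = k !* (p ∸ k) !≢0
  C*k![p-k]!≡p! : (p C k) * (k ! * (p ∸ k) !) ≡ p !
  C*k![p-k]!≡p! = trans (cong (_* (k ! * (p ∸ k) !)) (nCk≡n!/k![n-k]! (<⇒≤ k<p)))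
                        (m/n*n≡m (k![n∸k]!∣n! (<⇒≤ k<p)))
  p∣C*k![p-k]! : p ∣ (p C k) * (k ! * (p ∸ k) !)
  p∣C*k![p-k]! = subst (p ∣_) (sym C*k![p-k]!≡p!) (m∣m*n (p-1 !))
... | inj₁ p∣C = p∣C
... | inj₂ p∣k![p-k]! with euclidsLemma (k !) ((p ∸ k) !) pp p∣k![p-k]!
...   | inj₁ p∣k!     = ⊥-elim (prime∤! pp k k<p p∣k!)
...   | inj₂ p∣[p-k]! = ⊥-elim (prime∤! pp (p ∸ k) (∸-monoʳ-< 0<k (<⇒≤ k<p)) p∣[p-k]!)

^-∣-^ : ∀ q {m n} → m ≤ n → q ^ m ∣ q ^ n
^-∣-^ q {m} {n} m≤n =
  subst (q ^ m ∣_) (trans (sym (^-distribˡ-+-* q m (n ∸ m))) (cong (q ^_) (m+[n∸m]≡n m≤n))) (m∣m*n (q ^ (n ∸ m)))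

∣∧<⇒≡0 : ∀ {m k} → m ∣ k → k < m → k ≡ 0
∣∧<⇒≡0 {k = zero}  _   _   = refl
∣∧<⇒≡0 {k = suc k} m∣k k<m = ⊥-elim (<⇒≱ k<m (∣⇒≤ m∣k))

-- Congruences of integers

-- A record rather than a definition, so that i, j and n can be inferred from a proof.
infix 4 _≡_[mod_]
record _≡_[mod_] (i j : ℤ) (n : ℕ) : Set where
  constructor mod-by
  field ∣-difference : + n ∣ℤ i ℤ.- j

open _≡_[mod_] public

module _ {n : ℕ} where

  ≡-mod-reflexive : ∀ {i j} → i ≡ j → i ≡ j [mod n ]
  ≡-mod-reflexive {i} refl = mod-by (ℤ∣.divides 0ℤ (trans (ℤ.+-inverseʳ i) (sym (ℤ.*-zeroˡ (+ n)))))

  ≡-mod-refl : ∀ {i} → i ≡ i [mod n ]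
  ≡-mod-refl = ≡-mod-reflexive refl

  ≡-mod-sym : ∀ {i j} → i ≡ j [mod n ] → j ≡ i [mod n ]
  ≡-mod-sym {i} {j} (mod-by n∣i-j) = mod-by (subst (+ n ∣ℤ_) (negate i j) (ℤ∣.∣m⇒∣-m n∣i-j))
    where
    negate : ∀ i j → ℤ.- (i ℤ.- j) ≡ j ℤ.- i
    negate = solve-∀

  ≡-mod-trans : ∀ {i j k} → i ≡ j [mod n ] → j ≡ k [mod n ] → i ≡ k [mod n ]
  ≡-mod-trans {i} {j} {k} (mod-by n∣i-j) (mod-by n∣j-k) =
    mod-by (subst (+ n ∣ℤ_) (ℤ.+-minus-telescope i j k) (ℤ∣.∣m∣n⇒∣m+n n∣i-j n∣j-k))

  ≡-mod-setoid : Setoid _ _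
  ≡-mod-setoid = record
    { Carrier = ℤ
    ; _≈_ = _≡_[mod n ]
    ; isEquivalence = record { refl = ≡-mod-refl ; sym = ≡-mod-sym ; trans = ≡-mod-trans } }

  +-cong-mod : ∀ {i j k l} → i ≡ j [mod n ] → k ≡ l [mod n ] → i ℤ.+ k ≡ j ℤ.+ l [mod n ]
  +-cong-mod {i} {j} {k} {l} (mod-by n∣i-j) (mod-by n∣k-l) =
    mod-by (subst (+ n ∣ℤ_) (interchange i j k l) (ℤ∣.∣m∣n⇒∣m+n n∣i-j n∣k-l))
    where
    interchange : ∀ i j k l → (i ℤ.- j) ℤ.+ (k ℤ.- l) ≡ (i ℤ.+ k) ℤ.- (j ℤ.+ l)
    interchange = solve-∀

  +-congˡ-mod : ∀ c {i j} → i ≡ j [mod n ] → c ℤ.+ i ≡ c ℤ.+ j [mod n ]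
  +-congˡ-mod c = +-cong-mod (≡-mod-refl {c})

  +-congʳ-mod : ∀ c {i j} → i ≡ j [mod n ] → i ℤ.+ c ≡ j ℤ.+ c [mod n ]
  +-congʳ-mod c i≡j = +-cong-mod i≡j (≡-mod-refl {c})

  neg-cong-mod : ∀ {i j} → i ≡ j [mod n ] → ℤ.- i ≡ ℤ.- j [mod n ]
  neg-cong-mod {i} {j} (mod-by n∣i-j) = mod-by (subst (+ n ∣ℤ_) (negate i j) (ℤ∣.∣m⇒∣-m n∣i-j))
    where
    negate : ∀ i j → ℤ.- (i ℤ.- j) ≡ ℤ.- i ℤ.- ℤ.- j
    negate = solve-∀

  *-congˡ-mod : ∀ c {i j} → i ≡ j [mod n ] → c ℤ.* i ≡ c ℤ.* j [mod n ]
  *-congˡ-mod c {i} {j} (mod-by n∣i-j) = mod-by (subst (+ n ∣ℤ_) (distrib c i j) (ℤ∣.∣n⇒∣m*n c n∣i-j))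
    where
    distrib : ∀ c i j → c ℤ.* (i ℤ.- j) ≡ c ℤ.* i ℤ.- c ℤ.* j
    distrib = solve-∀

  *-congʳ-mod : ∀ c {i j} → i ≡ j [mod n ] → i ℤ.* c ≡ j ℤ.* c [mod n ]
  *-congʳ-mod c {i} {j} i≡j = subst₂ _≡_[mod n ] (ℤ.*-comm c i) (ℤ.*-comm c j) (*-congˡ-mod c i≡j)

  +-multiple-mod : ∀ i k → i ℤ.+ k ℤ.* + n ≡ i [mod n ]
  +-multiple-mod i k = mod-by (ℤ∣.divides k (cancel i k (+ n)))
    where
    cancel : ∀ i k n → i ℤ.+ k ℤ.* n ℤ.- i ≡ k ℤ.* n
    cancel = solve-∀

  ≡-mod-weaken : ∀ {d i j} → d ∣ n → i ≡ j [mod n ] → i ≡ j [mod d ]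
  ≡-mod-weaken d∣n (mod-by n∣i-j) = mod-by (ℤ∣.∣-trans (ℤ∣.∣ᵤ⇒∣ d∣n) n∣i-j)

*-scale-mod : ∀ c {i j} → i ≡ j [mod n ] → + c ℤ.* i ≡ + c ℤ.* j [mod c * n ]
*-scale-mod {n} c {i} {j} (mod-by (ℤ∣.divides k i-j≡kn)) = mod-by (ℤ∣.divides k (begin
  + c ℤ.* i ℤ.- + c ℤ.* j ≡⟨ distrib (+ c) i j ⟨
  + c ℤ.* (i ℤ.- j)       ≡⟨ cong (+ c ℤ.*_) i-j≡kn ⟩
  + c ℤ.* (k ℤ.* + n)     ≡⟨ rearrange (+ c) k (+ n) ⟩
  k ℤ.* (+ c ℤ.* + n)     ≡⟨ cong (k ℤ.*_) (ℤ.pos-* c n) ⟨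
  k ℤ.* + (c * n)         ∎))
  where
  open ≡-Reasoning
  distrib : ∀ c i j → c ℤ.* (i ℤ.- j) ≡ c ℤ.* i ℤ.- c ℤ.* j
  distrib = solve-∀
  rearrange : ∀ c k n → c ℤ.* (k ℤ.* n) ≡ k ℤ.* (c ℤ.* n)
  rearrange = solve-∀

module ≡-mod-Reasoning (n : ℕ) = Relation.Binary.Reasoning.Setoid (≡-mod-setoid {n})

∣⇒≡0-mod : ∀ {d k} → d ∣ k → + k ≡ 0ℤ [mod d ]
∣⇒≡0-mod {d} {k} d∣k = mod-by (subst (+ d ∣ℤ_) (sym (ℤ.+-identityʳ (+ k))) (ℤ∣.∣ᵤ⇒∣ d∣k))

≡0-mod⇒∣ : ∀ {d k} → + k ≡ 0ℤ [mod d ] → d ∣ k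
≡0-mod⇒∣ {d} {k} (mod-by d∣k-0) = ℤ∣.∣⇒∣ᵤ (subst (+ d ∣ℤ_) (ℤ.+-identityʳ (+ k)) d∣k-0)

pos-*-congʳ-mod : ∀ {d a a'} c → + a ≡ + a' [mod d ] → + (a * c) ≡ + (a' * c) [mod d ]
pos-*-congʳ-mod {d} {a} {a'} c a≡a' =
  subst₂ _≡_[mod d ] (sym (ℤ.pos-* a c)) (sym (ℤ.pos-* a' c)) (*-congʳ-mod (+ c) a≡a')

pos-linear : ∀ a b c → + (a + b * c) ≡ + a ℤ.+ + b ℤ.* + c
pos-linear a b c = trans (ℤ.pos-+ a (b * c)) (cong (λ x → + a ℤ.+ x) (ℤ.pos-* b c))

%ℕ-≡-mod : ∀ i n .{{_ : NonZero n}} → + (i %ℕ n) ≡ i [mod n ]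
%ℕ-≡-mod i n = ≡-mod-trans (≡-mod-sym (+-multiple-mod (+ (i %ℕ n)) (i /ℕ n)))
                           (≡-mod-reflexive (sym (a≡a%ℕn+[a/ℕn]*n i n)))

≤∧≡-mod∧<⇒≡ : ∀ {M X Y} → Y ≤ X → X < M → + X ≡ + Y [mod M ] → X ≡ Y
≤∧≡-mod∧<⇒≡ {M} {X} {Y} Y≤X X<M (mod-by M∣X-Y) =
  ≤-antisym (m∸n≡0⇒m≤n (∣∧<⇒≡0 M∣X∸Y (≤-<-trans (m∸n≤m X Y) X<M))) Y≤X
  where
  M∣X∸Y : M ∣ X ∸ Y
  M∣X∸Y = subst (M ∣_) (cong ℤ.∣_∣ (trans (ℤ.m-n≡m⊖n X Y) (ℤ.⊖-≥ Y≤X))) (ℤ∣.∣⇒∣ᵤ M∣X-Y)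

≡-mod∧<⇒≡ : ∀ {M X Y} → X < M → Y < M → + X ≡ + Y [mod M ] → X ≡ Y
≡-mod∧<⇒≡ {M} {X} {Y} X<M Y<M X≡Y with ≤-total Y X
... | inj₁ Y≤X = ≤∧≡-mod∧<⇒≡ Y≤X X<M X≡Y
... | inj₂ X≤Y = sym (≤∧≡-mod∧<⇒≡ X≤Y Y<M (≡-mod-sym X≡Y))

-- Linear congruences modulo a prime

prime∤⇒coprime : Prime p → ¬ p ∣ n → Coprime p n
prime∤⇒coprime pp p∤n (d∣p , d∣n) with prime⇒irreducible pp d∣p
... | inj₁ d≡1  = d≡1
... | inj₂ refl = ⊥-elim (p∤n d∣n)

pos-Bézout : ∀ a b c d → 1 + a * b ≡ c * d → 1ℤ ℤ.+ + a ℤ.* + b ≡ + c ℤ.* + d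
pos-Bézout a b c d eq = trans (sym (pos-linear 1 a b)) (trans (cong +_ eq) (ℤ.pos-* c d))

inverse-mod-prime : Prime p → ∀ i → ¬ (+ p ∣ℤ i) → Σ ℤ λ v → v ℤ.* i ≡ 1ℤ [mod p ]
inverse-mod-prime {p} pp (+ n) p∤n with coprime-Bézout (prime∤⇒coprime pp (p∤n ∘ ℤ∣.∣ᵤ⇒∣))
... | Bézout.+- x y 1+yn≡xp = ℤ.- + y , mod-by (ℤ∣.divides (ℤ.- + x) (begin
  ℤ.- + y ℤ.* + n ℤ.- 1ℤ     ≡⟨ negate (+ y) (+ n) ⟩
  ℤ.- (1ℤ ℤ.+ + y ℤ.* + n)   ≡⟨ cong ℤ.-_ (pos-Bézout y n x p 1+yn≡xp) ⟩
  ℤ.- (+ x ℤ.* + p)          ≡⟨ ℤ.neg-distribˡ-* (+ x) (+ p) ⟩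
  ℤ.- + x ℤ.* + p            ∎))
  where
  open ≡-Reasoning
  negate : ∀ y n → ℤ.- y ℤ.* n ℤ.- 1ℤ ≡ ℤ.- (1ℤ ℤ.+ y ℤ.* n)
  negate = solve-∀
... | Bézout.-+ x y 1+xp≡yn = + y , mod-by (ℤ∣.divides (+ x) (begin
  + y ℤ.* + n ℤ.- 1ℤ            ≡⟨ cong (ℤ._- 1ℤ) (pos-Bézout x p y n 1+xp≡yn) ⟨
  1ℤ ℤ.+ + x ℤ.* + p ℤ.- 1ℤ     ≡⟨ cancel (+ x ℤ.* + p) ⟩
  + x ℤ.* + p                   ∎))
  where
  open ≡-Reasoning
  cancel : ∀ i → 1ℤ ℤ.+ i ℤ.- 1ℤ ≡ i
  cancel = solve-∀
inverse-mod-prime {p} pp -[1+ n ] p∤i with inverse-mod-prime pp (+ suc n) (p∤i ∘ ℤ∣.∣m⇒∣-m)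
... | v , v[1+n]≡1 = ℤ.- v , subst (λ w → w ≡ 1ℤ [mod p ]) (neg*neg v (+ suc n)) v[1+n]≡1
  where
  neg*neg : ∀ v i → v ℤ.* i ≡ ℤ.- v ℤ.* ℤ.- i
  neg*neg = solve-∀

linear-solvable-mod-prime : Prime p → ∀ i → ¬ (+ p ∣ℤ i) → ∀ j →
                            Σ ℕ λ t → t < p × + t ℤ.* i ≡ j [mod p ]
linear-solvable-mod-prime {p} pp i p∤i j with inverse-mod-prime pp i p∤i
... | v , vi≡1 = (j ℤ.* v) %ℕ p , n%ℕd<d (j ℤ.* v) p , (begin
  + ((j ℤ.* v) %ℕ p) ℤ.* i  ≈⟨ *-congʳ-mod i (%ℕ-≡-mod (j ℤ.* v) p) ⟩
  j ℤ.* v ℤ.* i             ≡⟨ ℤ.*-assoc j v i ⟩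
  j ℤ.* (v ℤ.* i)           ≈⟨ *-congˡ-mod j vi≡1 ⟩
  j ℤ.* 1ℤ                  ≡⟨ ℤ.*-identityʳ j ⟩
  j                         ∎)
  where
  instance _ = prime⇒nonZero pp
  open ≡-mod-Reasoning p

exact-power-below : ∀ q i N → ¬ (+ (q ^ N) ∣ℤ i) →
                    Σ ℕ λ s → s < N × (+ (q ^ s) ∣ℤ i) × ¬ (+ (q ^ suc s) ∣ℤ i)
exact-power-below q i zero    1∤i = ⊥-elim (1∤i (ℤ∣.divides i (sym (ℤ.*-identityʳ i))))
exact-power-below q i (suc N) q^N+1∤i with + (q ^ N) ℤ∣.∣? i
... | yes q^N∣i = N , ≤-refl , q^N∣i , q^N+1∤i
... | no  q^N∤i with exact-power-below q i N q^N∤i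
...   | s , s<N , q^s∣i , q^s+1∤i = s , m<n⇒m<1+n s<N , q^s∣i , q^s+1∤i

NoCommonPrime : ℕ → ℕ → Set
NoCommonPrime u M = ∀ {r} → Prime r → r ∣ u → ¬ r ∣ M

-- u = 1 + w·L/q^s is ≡ 1 modulo every prime factor of q L, and w·(d/q^s) ≡ (d' - d)/L (mod q).
coprime-multiplier : ∀ {q s L d d'} → Prime q → q ^ suc s ∣ L →
                     + (q ^ s) ∣ℤ d → ¬ (+ (q ^ suc s) ∣ℤ d) → d ≡ d' [mod L ] →
                     Σ ℕ λ u → NonZero u × NoCommonPrime u (q * L) × + u ℤ.* d ≡ d' [mod q * L ]
coprime-multiplier {q} {s} {L} {d} {d'} pq (divides k L≡k*q^s+1)
                   (ℤ∣.divides e d≡e*q^s) q^s+1∤d (mod-by (ℤ∣.divides c d-d'≡c*L))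
  = multiplier (linear-solvable-mod-prime pq e q∤e (ℤ.- c))
  where
  q∤e : ¬ (+ q ∣ℤ e)
  q∤e (ℤ∣.divides f e≡f*q) = q^s+1∤d (ℤ∣.divides f (begin
    d                         ≡⟨ d≡e*q^s ⟩
    e ℤ.* + (q ^ s)           ≡⟨ cong (ℤ._* + (q ^ s)) e≡f*q ⟩
    f ℤ.* + q ℤ.* + (q ^ s)   ≡⟨ ℤ.*-assoc f (+ q) (+ (q ^ s)) ⟩
    f ℤ.* (+ q ℤ.* + (q ^ s)) ≡⟨ cong (f ℤ.*_) (ℤ.pos-* q (q ^ s)) ⟨
    f ℤ.* + (q ^ suc s)       ∎))
    where open ≡-Reasoning

  L₁ = k * q
  L≡L₁*q^s : L ≡ L₁ * q ^ s
  L≡L₁*q^s = trans L≡k*q^s+1 (sym (*-assoc k q (q ^ s)))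

  prime∣q*L⇒∣L₁ : ∀ {r} → Prime r → r ∣ q * L → r ∣ L₁
  prime∣q*L⇒∣L₁ {r} pr r∣qL with euclidsLemma q L pr r∣qL
  ... | inj₁ r∣q = ∣n⇒∣m*n k r∣q
  ... | inj₂ r∣L with euclidsLemma L₁ (q ^ s) pr (subst (r ∣_) L≡L₁*q^s r∣L)
  ...   | inj₁ r∣L₁  = r∣L₁
  ...   | inj₂ r∣q^s = ∣n⇒∣m*n k (prime∣^⇒∣ q s pr r∣q^s)

  multiplier : (Σ ℕ λ w → w < q × + w ℤ.* e ≡ ℤ.- c [mod q ]) →
               Σ ℕ λ u → NonZero u × NoCommonPrime u (q * L) × + u ℤ.* d ≡ d' [mod q * L ]
  multiplier (w , _ , we≡-c) = 1 + w * L₁ , _ , no-common-prime ,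
    subst (+ (1 + w * L₁) ℤ.* d ≡ d' [mod_]) (*-comm L q) (begin
      + (1 + w * L₁) ℤ.* d                   ≡⟨ cong (ℤ._* d) (pos-linear 1 w L₁) ⟩
      (1ℤ ℤ.+ W ℤ.* + L₁) ℤ.* d              ≡⟨ expand W (+ L₁) d ⟩
      d ℤ.+ W ℤ.* + L₁ ℤ.* d                 ≡⟨ cong (λ x → d ℤ.+ W ℤ.* + L₁ ℤ.* x) d≡e*q^s ⟩
      d ℤ.+ W ℤ.* + L₁ ℤ.* (e ℤ.* + (q ^ s)) ≡⟨ regroup d W (+ L₁) e (+ (q ^ s)) ⟩
      d ℤ.+ + L₁ ℤ.* + (q ^ s) ℤ.* (W ℤ.* e) ≡⟨ cong (λ x → d ℤ.+ x ℤ.* (W ℤ.* e)) L≡L₁*q^s' ⟨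
      d ℤ.+ + L ℤ.* (W ℤ.* e)                ≈⟨ +-congˡ-mod d (*-scale-mod L we≡-c) ⟩
      d ℤ.+ + L ℤ.* ℤ.- c                    ≡⟨ rearrange d (+ L) c ⟩
      d ℤ.- (c ℤ.* + L)                      ≡⟨ cong (λ x → d ℤ.- x) d-d'≡c*L ⟨
      d ℤ.- (d ℤ.- d')                       ≡⟨ cancel d d' ⟩
      d'                                     ∎)
    where
    open ≡-mod-Reasoning (L * q)
    W = + w
    L≡L₁*q^s' : + L ≡ + L₁ ℤ.* + (q ^ s)
    L≡L₁*q^s' = trans (cong +_ L≡L₁*q^s) (ℤ.pos-* L₁ (q ^ s))
    expand : ∀ W L₁ d → (1ℤ ℤ.+ W ℤ.* L₁) ℤ.* d ≡ d ℤ.+ W ℤ.* L₁ ℤ.* d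
    expand = solve-∀
    regroup : ∀ d W L₁ e Q → d ℤ.+ W ℤ.* L₁ ℤ.* (e ℤ.* Q) ≡ d ℤ.+ L₁ ℤ.* Q ℤ.* (W ℤ.* e)
    regroup = solve-∀
    rearrange : ∀ d L c → d ℤ.+ L ℤ.* ℤ.- c ≡ d ℤ.- (c ℤ.* L)
    rearrange = solve-∀
    cancel : ∀ d d' → d ℤ.- (d ℤ.- d') ≡ d'
    cancel = solve-∀

    no-common-prime : NoCommonPrime (1 + w * L₁) (q * L)
    no-common-prime {r} pr r∣u r∣qL = prime∤1 pr
      (∣m+n∣m⇒∣n (subst (r ∣_) (+-comm 1 (w * L₁)) r∣u) (∣n⇒∣m*n w (prime∣q*L⇒∣L₁ pr r∣qL)))

-- Finite sums

∑ : {A : Set} → List A → (A → ℕ) → ℕ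
∑ []       g = 0
∑ (x ∷ xs) g = g x + ∑ xs g

∑-++ : ∀ (xs ys : List A) g → ∑ (xs ++ ys) g ≡ ∑ xs g + ∑ ys g
∑-++ []       ys g = refl
∑-++ (x ∷ xs) ys g = trans (cong (_+_ (g x)) (∑-++ xs ys g)) (sym (+-assoc (g x) _ _))

∑-cong : ∀ {g h : A → ℕ} → (∀ x → g x ≡ h x) → ∀ xs → ∑ xs g ≡ ∑ xs h
∑-cong g≗h []       = refl
∑-cong g≗h (x ∷ xs) = cong₂ _+_ (g≗h x) (∑-cong g≗h xs)

∑-mono : ∀ {g h : A → ℕ} → (∀ x → g x ≤ h x) → ∀ xs → ∑ xs g ≤ ∑ xs h
∑-mono g≤h []       = z≤n
∑-mono g≤h (x ∷ xs) = +-mono-≤ (g≤h x) (∑-mono g≤h xs)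

∑-+ : ∀ (xs : List A) g h → ∑ xs (λ x → g x + h x) ≡ ∑ xs g + ∑ xs h
∑-+ []       g h = refl
∑-+ (x ∷ xs) g h = trans (cong (_+_ (g x + h x)) (∑-+ xs g h)) (+-interchange (g x) (h x) _ _)

∑-*ʳ : ∀ (xs : List A) g c → ∑ xs (λ x → g x * c) ≡ ∑ xs g * c
∑-*ʳ []       g c = refl
∑-*ʳ (x ∷ xs) g c = trans (cong (_+_ (g x * c)) (∑-*ʳ xs g c)) (sym (*-distribʳ-+ c (g x) (∑ xs g)))

∑-const : ∀ (xs : List A) c → ∑ xs (λ _ → c) ≡ length xs * c
∑-const []       c = refl
∑-const (x ∷ xs) c = cong (_+_ c) (∑-const xs c)

∑-map : ∀ (f : B → A) xs g → ∑ (map f xs) g ≡ ∑ xs (g ∘ f)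
∑-map f []       g = refl
∑-map f (x ∷ xs) g = cong (_+_ (g (f x))) (∑-map f xs g)

∑-comm : ∀ (xs : List A) (ys : List B) (f : A → B → ℕ) →
         ∑ xs (λ x → ∑ ys (f x)) ≡ ∑ ys (λ y → ∑ xs (λ x → f x y))
∑-comm []       ys f = sym (trans (∑-const ys 0) (*-zeroʳ (length ys)))
∑-comm (x ∷ xs) ys f =
  trans (cong (_+_ (∑ ys (f x))) (∑-comm xs ys f)) (sym (∑-+ ys (f x) (λ y → ∑ xs (λ x → f x y))))

∑-cong-mod : ∀ d {g h : A → ℕ} → (∀ x → + g x ≡ + h x [mod d ]) →
             ∀ xs → + ∑ xs g ≡ + ∑ xs h [mod d ]
∑-cong-mod d g≡h []       = ≡-mod-refl
∑-cong-mod d g≡h (x ∷ xs) = +-cong-mod (g≡h x) (∑-cong-mod d g≡h xs)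

length≤∑-positive : ∀ xs {g : A → ℕ} → (∀ x → 1 ≤ g x) → length xs ≤ ∑ xs g
length≤∑-positive xs {g} 1≤g =
  subst (_≤ ∑ xs g) (trans (∑-const xs 1) (*-identityʳ (length xs))) (∑-mono 1≤g xs)

∑-positive-≡length : ∀ xs {g : A → ℕ} → (∀ x → 1 ≤ g x) → ∑ xs g ≡ length xs →
                     ∀ {x} → x ∈ xs → g x ≡ 1
∑-positive-≡length (y ∷ ys) {g} 1≤g sum≡len (here refl) = ≤-antisym gy≤1 (1≤g y)
  where
  gy≤1 : g y ≤ 1
  gy≤1 = +-cancelʳ-≤ (length ys) (g y) 1
    (≤-trans (+-monoʳ-≤ (g y) (length≤∑-positive ys 1≤g)) (≤-reflexive sum≡len))
∑-positive-≡length (y ∷ ys) {g} 1≤g sum≡len (there x∈ys) =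
  ∑-positive-≡length ys 1≤g tail-sum≡len x∈ys
  where
  tail-sum≡len : ∑ ys g ≡ length ys
  tail-sum≡len = ≤-antisym
    (+-cancelˡ-≤ 1 (∑ ys g) (length ys) (≤-trans (+-monoˡ-≤ (∑ ys g) (1≤g y)) (≤-reflexive sum≡len)))
    (length≤∑-positive ys 1≤g)

𝟙 : ∀ {P : A → Set} → Decidable P → A → ℕ
𝟙 P? x = if does (P? x) then 1 else 0

𝟙-yes : ∀ {P : A → Set} (P? : Decidable P) {x} → P x → 𝟙 P? x ≡ 1
𝟙-yes P? {x} px with P? x
... | yes _   = refl
... | no  ¬px = ⊥-elim (¬px px)

𝟙-no : ∀ {P : A → Set} (P? : Decidable P) {x} → ¬ P x → 𝟙 P? x ≡ 0
𝟙-no P? {x} ¬px with P? x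
... | yes px = ⊥-elim (¬px px)
... | no  _  = refl

∑-filter : ∀ {P : A → Set} (P? : Decidable P) xs g → ∑ (filter P? xs) g ≡ ∑ xs (λ x → 𝟙 P? x * g x)
∑-filter P? []       g = refl
∑-filter P? (x ∷ xs) g with P? x
... | yes _ = cong₂ _+_ (sym (+-identityʳ (g x))) (∑-filter P? xs g)
... | no  _ = ∑-filter P? xs g

δ : Fin n → Fin n → ℕ
δ x = 𝟙 (x Fin.≟_)

δ-refl : ∀ (x : Fin n) → δ x x ≡ 1
δ-refl x = 𝟙-yes (x Fin.≟_) refl

δ-≢ : ∀ {x y : Fin n} → x ≢ y → δ x y ≡ 0
δ-≢ {x = x} = 𝟙-no (x Fin.≟_)

δ-sym : ∀ (x y : Fin n) → δ x y ≡ δ y x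
δ-sym x y with x Fin.≟ y
... | yes refl = sym (δ-refl x)
... | no  x≢y  = sym (δ-≢ (x≢y ∘ sym))

count : Fin n → List (Fin n) → ℕ
count x xs = ∑ xs (δ x)

∑-allFin-suc : ∀ (g : Fin (suc n) → ℕ) → ∑ (allFin (suc n)) g ≡ g Fin.zero + ∑ (allFin n) (g ∘ Fin.suc)
∑-allFin-suc {n} g = cong (_+_ (g Fin.zero))
  (trans (cong (λ xs → ∑ xs g) (sym (map-tabulate id Fin.suc))) (∑-map Fin.suc (allFin n) g))

count-allFin : ∀ (x : Fin n) → count x (allFin n) ≡ 1
count-allFin {suc n} Fin.zero    = trans (∑-allFin-suc {n} (δ Fin.zero))
  (cong suc (trans (∑-const (allFin n) 0) (*-zeroʳ (length (allFin n)))))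
count-allFin {suc n} (Fin.suc x) = trans (∑-allFin-suc {n} (δ (Fin.suc x))) (count-allFin x)

∑-allFin-δ : ∀ (x : Fin n) c → ∑ (allFin n) (λ y → δ x y * c) ≡ c
∑-allFin-δ {n} x c =
  trans (∑-*ʳ (allFin n) (δ x) c) (trans (cong (_* c) (count-allFin x)) (*-identityˡ c))

δ-*-eval : ∀ (g : Fin n → ℕ) x y → δ x y * g y ≡ δ x y * g x
δ-*-eval g x y with x Fin.≟ y
... | yes refl = refl
... | no  _    = refl

∑-allFin-δ* : ∀ (x : Fin n) g → ∑ (allFin n) (λ y → δ x y * g y) ≡ g x
∑-allFin-δ* {n} x g = trans (∑-cong (δ-*-eval g x) (allFin n)) (∑-allFin-δ x (g x))

∑-allFin-δ-pair : ∀ (x y : Fin n) c d → ∑ (allFin n) (λ i → δ x i * c + δ y i * d) ≡ c + d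
∑-allFin-δ-pair {n} x y c d =
  trans (∑-+ (allFin n) (λ i → δ x i * c) (λ i → δ y i * d)) (cong₂ _+_ (∑-allFin-δ x c) (∑-allFin-δ y d))

two-terms≤∑ : ∀ (g : Fin n → ℕ) {x y} → x ≢ y → g x + g y ≤ ∑ (allFin n) g
two-terms≤∑ {n} g {x} {y} x≢y =
  subst (_≤ ∑ (allFin n) g) (∑-allFin-δ-pair x y (g x) (g y)) (∑-mono pointwise (allFin n))
  where
  pointwise : ∀ i → δ x i * g x + δ y i * g y ≤ g i
  pointwise i with x Fin.≟ i | y Fin.≟ i
  ... | yes refl | yes refl = ⊥-elim (x≢y refl)
  ... | yes refl | no  _    = ≤-reflexive (trans (+-identityʳ _) (+-identityʳ (g x)))
  ... | no  _    | yes refl = ≤-reflexive (+-identityʳ (g y))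
  ... | no  _    | no  _    = z≤n

∑-two-terms-mod : ∀ d (g : Fin n → ℕ) {x y} → x ≢ y → (∀ i → i ≢ x → i ≢ y → d ∣ g i) →
                  + ∑ (allFin n) g ≡ + (g x + g y) [mod d ]
∑-two-terms-mod {n} d g {x} {y} x≢y d∣others =
  ≡-mod-trans (∑-cong-mod d pointwise (allFin n)) (≡-mod-reflexive (cong +_ (∑-allFin-δ-pair x y (g x) (g y))))
  where
  pointwise : ∀ i → + g i ≡ + (δ x i * g x + δ y i * g y) [mod d ]
  pointwise i with x Fin.≟ i | y Fin.≟ i
  ... | yes refl | yes refl = ⊥-elim (x≢y refl)
  ... | yes refl | no  _    = ≡-mod-reflexive (cong +_ (sym (trans (+-identityʳ _) (+-identityʳ (g x)))))
  ... | no  _    | yes refl = ≡-mod-reflexive (cong +_ (sym (+-identityʳ (g y))))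
  ... | no  x≢i  | no  y≢i  = ∣⇒≡0-mod (d∣others i (x≢i ∘ sym) (y≢i ∘ sym))

∑-as-counts : ∀ (g : Fin n → ℕ) xs → ∑ xs g ≡ ∑ (allFin n) (λ m → count m xs * g m)
∑-as-counts {n} g []       = sym (trans (∑-const (allFin n) 0) (*-zeroʳ (length (allFin n))))
∑-as-counts {n} g (x ∷ xs) = begin
  g x + ∑ xs g
    ≡⟨ cong₂ _+_ (sym (∑-allFin-δ x (g x))) (∑-as-counts g xs) ⟩
  ∑ (allFin n) (λ m → δ x m * g x) + ∑ (allFin n) (λ m → count m xs * g m)
    ≡⟨ ∑-+ (allFin n) _ _ ⟨
  ∑ (allFin n) (λ m → δ x m * g x + count m xs * g m)
    ≡⟨ ∑-cong (λ m → trans (cong (_+ count m xs * g m) (pointwise m))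
                           (sym (*-distribʳ-+ (g m) (δ m x) (count m xs)))) (allFin n) ⟩
  ∑ (allFin n) (λ m → count m (x ∷ xs) * g m)  ∎
  where
  open ≡-Reasoning
  pointwise : ∀ m → δ x m * g x ≡ δ m x * g m
  pointwise m = trans (sym (δ-*-eval g x m)) (cong (_* g m) (δ-sym x m))

∑-counts : ∀ (xs : List (Fin n)) → ∑ (allFin n) (λ m → count m xs) ≡ length xs
∑-counts {n} xs = begin
  ∑ (allFin n) (λ m → count m xs)        ≡⟨ ∑-cong (λ m → *-identityʳ (count m xs)) (allFin n) ⟨
  ∑ (allFin n) (λ m → count m xs * 1)    ≡⟨ ∑-as-counts (λ _ → 1) xs ⟨
  ∑ xs (λ _ → 1)                         ≡⟨ ∑-const xs 1 ⟩
  length xs * 1                          ≡⟨ *-identityʳ (length xs) ⟩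
  length xs                              ∎
  where open ≡-Reasoning

count-filter-allFin : ∀ {P : Fin n → Set} (P? : Decidable P) x → count x (filter P? (allFin n)) ≡ 𝟙 P? x
count-filter-allFin {n} P? x = begin
  count x (filter P? (allFin n))               ≡⟨ ∑-filter P? (allFin n) (δ x) ⟩
  ∑ (allFin n) (λ y → 𝟙 P? y * δ x y)          ≡⟨ ∑-cong (λ y → *-comm (𝟙 P? y) (δ x y)) (allFin n) ⟩
  ∑ (allFin n) (λ y → δ x y * 𝟙 P? y)          ≡⟨ ∑-allFin-δ* x (𝟙 P?) ⟩
  𝟙 P? x                                       ∎
  where open ≡-Reasoning

-- The group ℤ_M, its group semiring, and tilings

module ℤMod (M : ℕ) .{{_ : NonZero M}} where

  G : Set
  G = Fin M

  infixl 6 _⊕_ _⊖_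
  infixr 7 _·_

  _⊕_ : G → G → G
  _⊕_ = addM

  _⊖_ : G → G → G
  x ⊖ y = (toℕ x + (M ∸ toℕ y)) mod M

  _·_ : ℕ → G → G
  u · x = (u * toℕ x) mod M

  0G : G
  0G = 0 mod M

  toℤ : G → ℤ
  toℤ x = + toℕ x

  toℤ-mod : ∀ X → toℤ (X mod M) ≡ + X [mod M ]
  toℤ-mod X = begin
    toℤ (X mod M)                    ≡⟨ cong +_ (toℕ-fromℕ< (m%n<n X M)) ⟩
    + (X % M)                        ≈⟨ +-multiple-mod (+ (X % M)) (+ (X / M)) ⟨
    + (X % M) ℤ.+ + (X / M) ℤ.* + M  ≡⟨ pos-linear (X % M) (X / M) M ⟨
    + (X % M + X / M * M)            ≡⟨ cong +_ (m≡m%n+[m/n]*n X M) ⟨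
    + X                              ∎
    where
    open ≡-mod-Reasoning M

  ≡-mod⇒≡ : ∀ {x y} → toℤ x ≡ toℤ y [mod M ] → x ≡ y
  ≡-mod⇒≡ {x} {y} = toℕ-injective ∘ ≡-mod∧<⇒≡ (toℕ<n x) (toℕ<n y)

  toℤ-⊕ : ∀ x y → toℤ (x ⊕ y) ≡ toℤ x ℤ.+ toℤ y [mod M ]
  toℤ-⊕ x y = ≡-mod-trans (toℤ-mod (toℕ x + toℕ y)) (≡-mod-reflexive (ℤ.pos-+ (toℕ x) (toℕ y)))

  toℤ-⊕-mod : ∀ x k → toℤ (x ⊕ k mod M) ≡ toℤ x ℤ.+ + k [mod M ]
  toℤ-⊕-mod x k = ≡-mod-trans (toℤ-⊕ x (k mod M)) (+-congˡ-mod (toℤ x) (toℤ-mod k))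

  toℤ-⊖ : ∀ x y → toℤ (x ⊖ y) ≡ toℤ x ℤ.- toℤ y [mod M ]
  toℤ-⊖ x y = begin
    toℤ (x ⊖ y)                      ≈⟨ toℤ-mod (toℕ x + (M ∸ toℕ y)) ⟩
    + (toℕ x + (M ∸ toℕ y))          ≡⟨ ℤ.pos-+ (toℕ x) (M ∸ toℕ y) ⟩
    toℤ x ℤ.+ + (M ∸ toℕ y)          ≡⟨ cong (λ w → toℤ x ℤ.+ w) (ℤ.⊖-≥ (<⇒≤ (toℕ<n y))) ⟨
    toℤ x ℤ.+ (M ℤ.⊖ toℕ y)          ≡⟨ cong (λ w → toℤ x ℤ.+ w) (ℤ.m-n≡m⊖n M (toℕ y)) ⟨
    toℤ x ℤ.+ (+ M ℤ.- toℤ y)        ≡⟨ rearrange (toℤ x) (toℤ y) (+ M) ⟩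
    toℤ x ℤ.- toℤ y ℤ.+ 1ℤ ℤ.* + M   ≈⟨ +-multiple-mod (toℤ x ℤ.- toℤ y) 1ℤ ⟩
    toℤ x ℤ.- toℤ y                  ∎
    where
    open ≡-mod-Reasoning M
    rearrange : ∀ x y m → x ℤ.+ (m ℤ.- y) ≡ x ℤ.- y ℤ.+ 1ℤ ℤ.* m
    rearrange = solve-∀

  toℤ-· : ∀ u x → toℤ (u · x) ≡ + u ℤ.* toℤ x [mod M ]
  toℤ-· u x = ≡-mod-trans (toℤ-mod (u * toℕ x)) (≡-mod-reflexive (ℤ.pos-* u (toℕ x)))

  toℤ-0G : toℤ 0G ≡ 0ℤ [mod M ]
  toℤ-0G = toℤ-mod 0

  ⊕-comm : ∀ x y → x ⊕ y ≡ y ⊕ x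
  ⊕-comm x y = cong (_mod M) (+-comm (toℕ x) (toℕ y))

  ⊕-assoc : ∀ x y z → (x ⊕ y) ⊕ z ≡ x ⊕ (y ⊕ z)
  ⊕-assoc x y z = ≡-mod⇒≡ (begin
    toℤ ((x ⊕ y) ⊕ z)               ≈⟨ toℤ-⊕ (x ⊕ y) z ⟩
    toℤ (x ⊕ y) ℤ.+ toℤ z           ≈⟨ +-congʳ-mod (toℤ z) (toℤ-⊕ x y) ⟩
    toℤ x ℤ.+ toℤ y ℤ.+ toℤ z       ≡⟨ ℤ.+-assoc (toℤ x) (toℤ y) (toℤ z) ⟩
    toℤ x ℤ.+ (toℤ y ℤ.+ toℤ z)     ≈⟨ +-congˡ-mod (toℤ x) (toℤ-⊕ y z) ⟨
    toℤ x ℤ.+ toℤ (y ⊕ z)           ≈⟨ toℤ-⊕ x (y ⊕ z) ⟨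
    toℤ (x ⊕ (y ⊕ z))               ∎)
    where open ≡-mod-Reasoning M

  ⊕-identityˡ : ∀ x → 0G ⊕ x ≡ x
  ⊕-identityˡ x = ≡-mod⇒≡ (begin
    toℤ (0G ⊕ x)          ≈⟨ toℤ-⊕ 0G x ⟩
    toℤ 0G ℤ.+ toℤ x      ≈⟨ +-congʳ-mod (toℤ x) toℤ-0G ⟩
    0ℤ ℤ.+ toℤ x          ≡⟨ ℤ.+-identityˡ (toℤ x) ⟩
    toℤ x                 ∎)
    where open ≡-mod-Reasoning M

  ⊕-⊖-cancel : ∀ x y → y ⊕ (x ⊖ y) ≡ x
  ⊕-⊖-cancel x y = ≡-mod⇒≡ (begin
    toℤ (y ⊕ (x ⊖ y))           ≈⟨ toℤ-⊕ y (x ⊖ y) ⟩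
    toℤ y ℤ.+ toℤ (x ⊖ y)       ≈⟨ +-congˡ-mod (toℤ y) (toℤ-⊖ x y) ⟩
    toℤ y ℤ.+ (toℤ x ℤ.- toℤ y) ≡⟨ cancel (toℤ x) (toℤ y) ⟩
    toℤ x                       ∎)
    where
    open ≡-mod-Reasoning M
    cancel : ∀ x y → y ℤ.+ (x ℤ.- y) ≡ x
    cancel = solve-∀

  ⊕≡⇒≡⊖ : ∀ {x y z} → y ⊕ z ≡ x → z ≡ x ⊖ y
  ⊕≡⇒≡⊖ {x} {y} {z} refl = ≡-mod⇒≡ (begin
    toℤ z                             ≡⟨ cancel (toℤ y) (toℤ z) ⟩
    toℤ y ℤ.+ toℤ z ℤ.- toℤ y         ≈⟨ +-congʳ-mod (ℤ.- toℤ y) (toℤ-⊕ y z) ⟨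
    toℤ (y ⊕ z) ℤ.- toℤ y             ≈⟨ toℤ-⊖ (y ⊕ z) y ⟨
    toℤ ((y ⊕ z) ⊖ y)                 ∎)
    where
    open ≡-mod-Reasoning M
    cancel : ∀ y z → z ≡ y ℤ.+ z ℤ.- y
    cancel = solve-∀

  ·-identityˡ : ∀ x → 1 · x ≡ x
  ·-identityˡ x = ≡-mod⇒≡ (≡-mod-trans (toℤ-· 1 x) (≡-mod-reflexive (ℤ.*-identityˡ (toℤ x))))

  ·-suc : ∀ k x → suc k · x ≡ x ⊕ k · x
  ·-suc k x = ≡-mod⇒≡ (begin
    toℤ (suc k · x)                 ≈⟨ toℤ-· (suc k) x ⟩
    + suc k ℤ.* toℤ x               ≡⟨ distrib (+ k) (toℤ x) ⟩
    toℤ x ℤ.+ + k ℤ.* toℤ x         ≈⟨ +-congˡ-mod (toℤ x) (toℤ-· k x) ⟨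
    toℤ x ℤ.+ toℤ (k · x)           ≈⟨ toℤ-⊕ x (k · x) ⟨
    toℤ (x ⊕ k · x)                 ∎)
    where
    open ≡-mod-Reasoning M
    distrib : ∀ k x → (1ℤ ℤ.+ k) ℤ.* x ≡ x ℤ.+ k ℤ.* x
    distrib = solve-∀

  ·-assoc : ∀ a b x → a · (b · x) ≡ (a * b) · x
  ·-assoc a b x = ≡-mod⇒≡ (begin
    toℤ (a · (b · x))               ≈⟨ toℤ-· a (b · x) ⟩
    + a ℤ.* toℤ (b · x)             ≈⟨ *-congˡ-mod (+ a) (toℤ-· b x) ⟩
    + a ℤ.* (+ b ℤ.* toℤ x)         ≡⟨ ℤ.*-assoc (+ a) (+ b) (toℤ x) ⟨
    + a ℤ.* + b ℤ.* toℤ x           ≡⟨ cong (ℤ._* toℤ x) (ℤ.pos-* a b) ⟨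
    + (a * b) ℤ.* toℤ x             ≈⟨ toℤ-· (a * b) x ⟨
    toℤ ((a * b) · x)               ∎)
    where open ≡-mod-Reasoning M

  scaled-difference⇒⊕≡ : ∀ u {a a' b b'} → + u ℤ.* (toℤ a ℤ.- toℤ a') ≡ toℤ b' ℤ.- toℤ b [mod M ] →
                         u · a ⊕ b ≡ u · a' ⊕ b'
  scaled-difference⇒⊕≡ u {a} {a'} {b} {b'} ud≡d' = ≡-mod⇒≡ (begin
    toℤ (u · a ⊕ b)                          ≈⟨ toℤ-⊕ (u · a) b ⟩
    toℤ (u · a) ℤ.+ y                        ≈⟨ +-congʳ-mod y (toℤ-· u a) ⟩
    U ℤ.* x ℤ.+ y                            ≡⟨ split U x x' y ⟩
    U ℤ.* (x ℤ.- x') ℤ.+ (U ℤ.* x' ℤ.+ y)    ≈⟨ +-congʳ-mod (U ℤ.* x' ℤ.+ y) ud≡d' ⟩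
    y' ℤ.- y ℤ.+ (U ℤ.* x' ℤ.+ y)            ≡⟨ recombine U x' y y' ⟩
    U ℤ.* x' ℤ.+ y'                          ≈⟨ +-congʳ-mod y' (toℤ-· u a') ⟨
    toℤ (u · a') ℤ.+ y'                      ≈⟨ toℤ-⊕ (u · a') b' ⟨
    toℤ (u · a' ⊕ b')                        ∎)
    where
    open ≡-mod-Reasoning M
    U = + u
    x = toℤ a
    x' = toℤ a'
    y = toℤ b
    y' = toℤ b'
    split : ∀ U x x' y → U ℤ.* x ℤ.+ y ≡ U ℤ.* (x ℤ.- x') ℤ.+ (U ℤ.* x' ℤ.+ y)
    split = solve-∀
    recombine : ∀ U x' y y' → y' ℤ.- y ℤ.+ (U ℤ.* x' ℤ.+ y) ≡ U ℤ.* x' ℤ.+ y'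
    recombine = solve-∀

  δ-⊕ : ∀ (n x y : G) → δ n (x ⊕ y) ≡ δ (n ⊖ x) y
  δ-⊕ n x y with n Fin.≟ x ⊕ y
  ... | yes n≡x⊕y = sym (trans (cong (λ w → δ w y) (sym (⊕≡⇒≡⊖ {n} {x} {y} (sym n≡x⊕y)))) (δ-refl y))
  ... | no  n≢x⊕y = sym (δ-≢ λ n⊖x≡y → n≢x⊕y (trans (sym (⊕-⊖-cancel n x)) (cong (x ⊕_) n⊖x≡y)))

  allG : List G
  allG = allFin M

  -- Lists compared by multiplicities (_≈_ below) model the group semiring ℕ[ℤ_M]:
  -- _++_ is its addition and _⊗_ its multiplication.
  infixl 7 _⊗_
  _⊗_ : List G → List G → List G
  []       ⊗ ys = []
  (x ∷ xs) ⊗ ys = map (x ⊕_) ys ++ xs ⊗ ys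

  ∑-⊗ : ∀ g (xs ys : List G) → ∑ (xs ⊗ ys) g ≡ ∑ xs (λ x → ∑ ys (λ y → g (x ⊕ y)))
  ∑-⊗ g []       ys = refl
  ∑-⊗ g (x ∷ xs) ys =
    trans (∑-++ (map (x ⊕_) ys) (xs ⊗ ys) g) (cong₂ _+_ (∑-map (x ⊕_) ys g) (∑-⊗ g xs ys))

  count-⊗ : ∀ (n : G) xs ys → count n (xs ⊗ ys) ≡ ∑ xs (λ x → count (n ⊖ x) ys)
  count-⊗ n xs ys = trans (∑-⊗ (δ n) xs ys) (∑-cong (λ x → ∑-cong (δ-⊕ n x) ys) xs)

  count-⊗-convolution : ∀ (n : G) xs ys → count n (xs ⊗ ys) ≡ ∑ allG (λ m → count m xs * count (n ⊖ m) ys)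
  count-⊗-convolution n xs ys = trans (count-⊗ n xs ys) (∑-as-counts (λ x → count (n ⊖ x) ys) xs)

  length-⊗ : ∀ (xs ys : List G) → length (xs ⊗ ys) ≡ length xs * length ys
  length-⊗ []       ys = refl
  length-⊗ (x ∷ xs) ys = trans (length-++ (map (x ⊕_) ys))
    (cong₂ _+_ (length-map (x ⊕_) ys) (length-⊗ xs ys))

  count-⊗-allG : ∀ (n : G) xs → count n (xs ⊗ allG) ≡ length xs
  count-⊗-allG n xs = begin
    count n (xs ⊗ allG)                   ≡⟨ count-⊗ n xs allG ⟩
    ∑ xs (λ x → count (n ⊖ x) allG)       ≡⟨ ∑-cong (λ x → count-allFin (n ⊖ x)) xs ⟩
    ∑ xs (λ _ → 1)                        ≡⟨ ∑-const xs 1 ⟩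
    length xs * 1                         ≡⟨ *-identityʳ (length xs) ⟩
    length xs                             ∎
    where open ≡-Reasoning

  infix 4 _≈_
  record _≈_ (xs ys : List G) : Set where
    constructor same-counts
    field counts-≡ : ∀ m → count m xs ≡ count m ys
  open _≈_

  ≈-refl : ∀ {xs} → xs ≈ xs
  ≈-refl = same-counts λ _ → refl

  ≈-trans : ∀ {xs ys zs} → xs ≈ ys → ys ≈ zs → xs ≈ zs
  ≈-trans xs≈ys ys≈zs = same-counts λ m → trans (counts-≡ xs≈ys m) (counts-≡ ys≈zs m)

  ≈-isEquivalence : IsEquivalence _≈_
  ≈-isEquivalence = record
    { refl  = ≈-refl
    ; sym   = λ xs≈ys → same-counts λ m → sym (counts-≡ xs≈ys m)
    ; trans = ≈-trans }

  count-++ : ∀ (n : G) xs ys → count n (xs ++ ys) ≡ count n xs + count n ys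
  count-++ n xs ys = ∑-++ xs ys (δ n)

  ++-cong : ∀ {xs xs' ys ys'} → xs ≈ xs' → ys ≈ ys' → xs ++ ys ≈ xs' ++ ys'
  ++-cong {xs} {xs'} {ys} {ys'} xs≈xs' ys≈ys' = same-counts λ m →
    trans (count-++ m xs ys)
          (trans (cong₂ _+_ (counts-≡ xs≈xs' m) (counts-≡ ys≈ys' m)) (sym (count-++ m xs' ys')))

  ⊗-cong : ∀ {xs xs' ys ys'} → xs ≈ xs' → ys ≈ ys' → xs ⊗ ys ≈ xs' ⊗ ys'
  ⊗-cong {xs} {xs'} {ys} {ys'} xs≈xs' ys≈ys' = same-counts λ n → begin
    count n (xs ⊗ ys)
      ≡⟨ count-⊗-convolution n xs ys ⟩
    ∑ allG (λ m → count m xs * count (n ⊖ m) ys)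
      ≡⟨ ∑-cong (λ m → cong₂ _*_ (counts-≡ xs≈xs' m) (counts-≡ ys≈ys' (n ⊖ m))) allG ⟩
    ∑ allG (λ m → count m xs' * count (n ⊖ m) ys')
      ≡⟨ count-⊗-convolution n xs' ys' ⟨
    count n (xs' ⊗ ys')  ∎
    where open ≡-Reasoning

  ⊗-congˡ : ∀ xs {ys ys'} → ys ≈ ys' → xs ⊗ ys ≈ xs ⊗ ys'
  ⊗-congˡ xs = ⊗-cong {xs} ≈-refl

  ⊗-congʳ : ∀ ys {xs xs'} → xs ≈ xs' → xs ⊗ ys ≈ xs' ⊗ ys
  ⊗-congʳ ys xs≈xs' = ⊗-cong xs≈xs' (≈-refl {ys})

  ++-comm : ∀ (xs ys : List G) → xs ++ ys ≈ ys ++ xs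
  ++-comm xs ys = same-counts λ m →
    trans (count-++ m xs ys) (trans (+-comm (count m xs) _) (sym (count-++ m ys xs)))

  ⊗-comm : ∀ (xs ys : List G) → xs ⊗ ys ≈ ys ⊗ xs
  ⊗-comm xs ys = same-counts λ n → begin
    count n (xs ⊗ ys)                               ≡⟨ ∑-⊗ (δ n) xs ys ⟩
    ∑ xs (λ x → ∑ ys (λ y → δ n (x ⊕ y)))           ≡⟨ ∑-comm xs ys (λ x y → δ n (x ⊕ y)) ⟩
    ∑ ys (λ y → ∑ xs (λ x → δ n (x ⊕ y)))
      ≡⟨ ∑-cong (λ y → ∑-cong (λ x → cong (δ n) (⊕-comm x y)) xs) ys ⟩
    ∑ ys (λ y → ∑ xs (λ x → δ n (y ⊕ x)))           ≡⟨ ∑-⊗ (δ n) ys xs ⟨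
    count n (ys ⊗ xs)                               ∎
    where open ≡-Reasoning

  ⊗-assoc : ∀ (xs ys zs : List G) → (xs ⊗ ys) ⊗ zs ≈ xs ⊗ (ys ⊗ zs)
  ⊗-assoc xs ys zs = same-counts λ n → begin
    count n ((xs ⊗ ys) ⊗ zs)
      ≡⟨ ∑-⊗ (δ n) (xs ⊗ ys) zs ⟩
    ∑ (xs ⊗ ys) (λ w → ∑ zs (λ z → δ n (w ⊕ z)))
      ≡⟨ ∑-⊗ _ xs ys ⟩
    ∑ xs (λ x → ∑ ys (λ y → ∑ zs (λ z → δ n ((x ⊕ y) ⊕ z))))
      ≡⟨ ∑-cong (λ x → ∑-cong (λ y → ∑-cong (λ z → cong (δ n) (⊕-assoc x y z)) zs) ys) xs ⟩
    ∑ xs (λ x → ∑ ys (λ y → ∑ zs (λ z → δ n (x ⊕ (y ⊕ z)))))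
      ≡⟨ ∑-cong (λ x → ∑-⊗ (λ w → δ n (x ⊕ w)) ys zs) xs ⟨
    ∑ xs (λ x → ∑ (ys ⊗ zs) (λ w → δ n (x ⊕ w)))
      ≡⟨ ∑-⊗ (δ n) xs (ys ⊗ zs) ⟨
    count n (xs ⊗ (ys ⊗ zs))  ∎
    where open ≡-Reasoning

  ⊗-identityˡ : ∀ (xs : List G) → (0G ∷ []) ⊗ xs ≈ xs
  ⊗-identityˡ xs = same-counts λ n →
    trans (∑-⊗ (δ n) (0G ∷ []) xs) (trans (+-identityʳ _) (∑-cong (λ y → cong (δ n) (⊕-identityˡ y)) xs))

  ⊗-distribʳ : ∀ (xs ys zs : List G) → (ys ++ zs) ⊗ xs ≡ ys ⊗ xs ++ zs ⊗ xs
  ⊗-distribʳ xs []       zs = refl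
  ⊗-distribʳ xs (y ∷ ys) zs = trans (cong (map (y ⊕_) xs ++_) (⊗-distribʳ xs ys zs))
                                    (sym (++-assoc (map (y ⊕_) xs) (ys ⊗ xs) (zs ⊗ xs)))

  groupSemiring : CommutativeSemiring 0ℓ 0ℓ
  groupSemiring = record
    { isCommutativeSemiring = IsCommutativeSemiringˡ.isCommutativeSemiring record
      { +-isCommutativeMonoid = record
        { isMonoid = record
          { isSemigroup = record
            { isMagma = record { isEquivalence = ≈-isEquivalence ; ∙-cong = ++-cong }
            ; assoc = λ xs ys zs → same-counts λ m → cong (count m) (++-assoc xs ys zs) }
          ; identity = (λ _ → ≈-refl) , (λ xs → same-counts λ m → cong (count m) (++-identityʳ xs)) }
        ; comm = ++-comm }
      ; *-isCommutativeMonoid = record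
        { isMonoid = record
          { isSemigroup = record
            { isMagma = record { isEquivalence = ≈-isEquivalence ; ∙-cong = ⊗-cong }
            ; assoc = ⊗-assoc }
          ; identity = ⊗-identityˡ , (λ xs → ≈-trans (⊗-comm xs (0G ∷ [])) (⊗-identityˡ xs)) }
        ; comm = ⊗-comm }
      ; distribʳ = λ xs ys zs → same-counts λ m → cong (count m) (⊗-distribʳ xs ys zs)
      ; zeroˡ = λ _ → ≈-refl } }

  open import Algebra.Properties.Semiring.Exp (CommutativeSemiring.semiring groupSemiring)
    using () renaming (_^_ to _^⊗_)
  open import Algebra.Definitions.RawMonoid (CommutativeSemiring.+-rawMonoid groupSemiring)
    using () renaming (_×_ to _⨉_)
  private module Binomial = Algebra.Properties.CommutativeSemiring.Binomial groupSemiring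

  count-foldr-++ : ∀ (m : G) k (f : Fin k → List G) →
                   count m (Vector.foldr _++_ [] f) ≡ ∑ (allFin k) (λ i → count m (f i))
  count-foldr-++ m zero    f = refl
  count-foldr-++ m (suc k) f = trans (count-++ m (f Fin.zero) _)
    (trans (cong (_+_ (count m (f Fin.zero))) (count-foldr-++ m k (f ∘ Fin.suc))) (sym (∑-allFin-suc {k} _)))

  count-⨉ : ∀ (m : G) c xs → count m (c ⨉ xs) ≡ c * count m xs
  count-⨉ m zero    xs = refl
  count-⨉ m (suc c) xs = trans (count-++ m xs (c ⨉ xs)) (cong (_+_ (count m xs)) (count-⨉ m c xs))

  singleton-^⊗ : ∀ k x → (x ∷ []) ^⊗ k ≈ (k · x ∷ [])
  singleton-^⊗ zero    x = ≈-refl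
  singleton-^⊗ (suc k) x = same-counts λ m → begin
    count m ((x ∷ []) ⊗ ((x ∷ []) ^⊗ k))     ≡⟨ counts-≡ (⊗-congˡ (x ∷ []) (singleton-^⊗ k x)) m ⟩
    count m ((x ∷ []) ⊗ (k · x ∷ []))        ≡⟨ cong (λ y → δ m y + 0) (sym (·-suc k x)) ⟩
    count m (suc k · x ∷ [])                 ∎
    where open ≡-Reasoning

  module _ (x : G) (xs : List G) (m : G) (r : ℕ) where

    binomial-count : Fin (suc r) → ℕ
    binomial-count k = count m (Binomial.binomialTerm (x ∷ []) xs r k)

    binomial-count≡C* : ∀ k → binomial-count k ≡ (r C toℕ k) * count m (Binomial.binomial (x ∷ []) xs r k)
    binomial-count≡C* k = count-⨉ m (r C toℕ k) (Binomial.binomial (x ∷ []) xs r k)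

    binomial-count-first : binomial-count Fin.zero ≡ count m (xs ^⊗ r)
    binomial-count-first =
      trans (binomial-count≡C* Fin.zero) (trans (+-identityʳ _) (counts-≡ (⊗-identityˡ (xs ^⊗ r)) m))

    binomial-count-last : binomial-count (Fin.fromℕ r) ≡ δ m (r · x)
    binomial-count-last = begin
      binomial-count (Fin.fromℕ r)
        ≡⟨ binomial-count≡C* (Fin.fromℕ r) ⟩
      (r C toℕ (Fin.fromℕ r)) * count m (((x ∷ []) ^⊗ toℕ (Fin.fromℕ r)) ⊗ (xs ^⊗ (r ∸ toℕ (Fin.fromℕ r))))
        ≡⟨ cong (λ t → (r C t) * count m (((x ∷ []) ^⊗ t) ⊗ (xs ^⊗ (r ∸ t)))) (toℕ-fromℕ r) ⟩
      (r C r) * count m (((x ∷ []) ^⊗ r) ⊗ (xs ^⊗ (r ∸ r)))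
        ≡⟨ cong₂ (λ c t → c * count m (((x ∷ []) ^⊗ r) ⊗ (xs ^⊗ t))) (nCn≡1 r) (n∸n≡0 r) ⟩
      1 * count m (((x ∷ []) ^⊗ r) ⊗ (0G ∷ []))
        ≡⟨ *-identityˡ _ ⟩
      count m (((x ∷ []) ^⊗ r) ⊗ (0G ∷ []))
        ≡⟨ counts-≡ (⊗-comm ((x ∷ []) ^⊗ r) (0G ∷ [])) m ⟩
      count m ((0G ∷ []) ⊗ ((x ∷ []) ^⊗ r))
        ≡⟨ counts-≡ (⊗-identityˡ ((x ∷ []) ^⊗ r)) m ⟩
      count m ((x ∷ []) ^⊗ r)
        ≡⟨ counts-≡ (singleton-^⊗ r x) m ⟩
      δ m (r · x) + 0
        ≡⟨ +-identityʳ _ ⟩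
      δ m (r · x) ∎
      where open ≡-Reasoning

    binomial-count-middle : Prime r → ∀ k → k ≢ Fin.zero → k ≢ Fin.fromℕ r → r ∣ binomial-count k
    binomial-count-middle pr k k≢0 k≢r = subst (r ∣_) (sym (binomial-count≡C* k))
      (∣m⇒∣m*n _ (prime∣C pr (toℕ k) 0<k k<r))
      where
      0<k : 0 < toℕ k
      0<k = n≢0⇒n>0 (k≢0 ∘ toℕ-injective)
      k<r : toℕ k < r
      k<r = ≤∧≢⇒< (toℕ≤pred[n] k) (λ k≡r → k≢r (toℕ-injective (trans k≡r (sym (toℕ-fromℕ r)))))

  frobenius : ∀ {r} → Prime r → ∀ xs (m : G) →
              + count m (xs ^⊗ r) ≡ + count m (map (r ·_) xs) [mod r ]
  frobenius {suc r-1} pr []       m = ≡-mod-refl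
  -- Expand (x + xs)^r binomially; modulo r only the terms xs^r and x^r = r·x survive.
  frobenius {r@(suc r-1)} pr (x ∷ xs) m = begin
    + count m (((x ∷ []) ++ xs) ^⊗ r)
      ≡⟨ cong +_ (counts-≡ (Binomial.theorem r (x ∷ []) xs) m) ⟩
    + count m (Binomial.binomialExpansion (x ∷ []) xs r)
      ≡⟨ cong +_ (count-foldr-++ m (suc r) (Binomial.binomialTerm (x ∷ []) xs r)) ⟩
    + ∑ (allFin (suc r)) (binomial-count x xs m r)
      ≈⟨ ∑-two-terms-mod r (binomial-count x xs m r) (λ ()) (binomial-count-middle x xs m r pr) ⟩
    + (binomial-count x xs m r Fin.zero + binomial-count x xs m r (Fin.fromℕ r))
      ≡⟨ cong₂ (λ a b → + (a + b)) (binomial-count-first x xs m r) (binomial-count-last x xs m r) ⟩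
    + count m (xs ^⊗ r) ℤ.+ + δ m (r · x)
      ≈⟨ +-congʳ-mod (+ δ m (r · x)) (frobenius pr xs m) ⟩
    + count m (map (r ·_) xs) ℤ.+ + δ m (r · x)
      ≡⟨ cong +_ (+-comm (count m (map (r ·_) xs)) (δ m (r · x))) ⟩
    + count m (map (r ·_) (x ∷ xs))   ∎
    where open ≡-mod-Reasoning r

  length-^⊗ : ∀ xs k → length (xs ^⊗ k) ≡ length xs ^ k
  length-^⊗ xs zero    = refl
  length-^⊗ xs (suc k) = trans (length-⊗ xs (xs ^⊗ k)) (cong (length xs *_) (length-^⊗ xs k))

  length-allG : length allG ≡ M
  length-allG = length-tabulate id

  record Tiles (xs ys : List G) : Set where
    constructor tiles-by
    field counts-≡1 : ∀ n → count n (xs ⊗ ys) ≡ 1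
  open Tiles

  Tiles⇒≈allG : ∀ {xs ys} → Tiles xs ys → xs ⊗ ys ≈ allG
  Tiles⇒≈allG T = same-counts λ n → trans (counts-≡1 T n) (sym (count-allFin n))

  Tiles⇒length*length≡M : ∀ {xs ys} → Tiles xs ys → length xs * length ys ≡ M
  Tiles⇒length*length≡M {xs} {ys} T = begin
    length xs * length ys                  ≡⟨ length-⊗ xs ys ⟨
    length (xs ⊗ ys)                       ≡⟨ ∑-counts (xs ⊗ ys) ⟨
    ∑ allG (λ n → count n (xs ⊗ ys))       ≡⟨ ∑-cong (counts-≡1 T) allG ⟩
    ∑ allG (λ _ → 1)                       ≡⟨ ∑-const allG 1 ⟩
    length allG * 1                        ≡⟨ *-identityʳ (length allG) ⟩
    length allG                            ≡⟨ length-allG ⟩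
    M                                      ∎
    where open ≡-Reasoning

  count-^⊗-⊗-tile : ∀ {xs ys} → Tiles xs ys → ∀ k n → count n ((xs ^⊗ suc k) ⊗ ys) ≡ length xs ^ k
  count-^⊗-⊗-tile {xs} {ys} T k n = begin
    count n ((xs ⊗ (xs ^⊗ k)) ⊗ ys)      ≡⟨ counts-≡ (⊗-congʳ ys (⊗-comm xs (xs ^⊗ k))) n ⟩
    count n (((xs ^⊗ k) ⊗ xs) ⊗ ys)      ≡⟨ counts-≡ (⊗-assoc (xs ^⊗ k) xs ys) n ⟩
    count n ((xs ^⊗ k) ⊗ (xs ⊗ ys))      ≡⟨ counts-≡ (⊗-congˡ (xs ^⊗ k) (Tiles⇒≈allG T)) n ⟩
    count n ((xs ^⊗ k) ⊗ allG)           ≡⟨ count-⊗-allG n (xs ^⊗ k) ⟩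
    length (xs ^⊗ k)                     ≡⟨ length-^⊗ xs k ⟩
    length xs ^ k                        ∎
    where open ≡-Reasoning

  tiles-dilate-prime : ∀ {r} → Prime r → ¬ r ∣ M → ∀ {xs ys} → Tiles xs ys → Tiles (map (r ·_) xs) ys
  -- Every count c n is ≡ |xs|^(r-1) ≢ 0 (mod r), while the counts add up to |xs| |ys| = M.
  tiles-dilate-prime {r@(suc r-1)} pr r∤M {xs} {ys} T =
    tiles-by λ n → ∑-positive-≡length allG 1≤c ∑c≡length (∈-allFin n)
    where
    c : G → ℕ
    c n = count n (map (r ·_) xs ⊗ ys)

    c≡power : ∀ n → + c n ≡ + (length xs ^ r-1) [mod r ]
    c≡power n = begin
      + count n (map (r ·_) xs ⊗ ys)
        ≡⟨ cong +_ (count-⊗-convolution n (map (r ·_) xs) ys) ⟩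
      + ∑ allG (λ m → count m (map (r ·_) xs) * count (n ⊖ m) ys)
        ≈⟨ ∑-cong-mod r (λ m → pos-*-congʳ-mod (count (n ⊖ m) ys) (≡-mod-sym (frobenius pr xs m))) allG ⟩
      + ∑ allG (λ m → count m (xs ^⊗ r) * count (n ⊖ m) ys)
        ≡⟨ cong +_ (count-⊗-convolution n (xs ^⊗ r) ys) ⟨
      + count n ((xs ^⊗ r) ⊗ ys)
        ≡⟨ cong +_ (count-^⊗-⊗-tile T r-1 n) ⟩
      + (length xs ^ r-1)  ∎
      where open ≡-mod-Reasoning r

    r∤power : ¬ r ∣ length xs ^ r-1
    r∤power r∣power = r∤M (subst (r ∣_) (Tiles⇒length*length≡M T)
      (∣m⇒∣m*n (length ys) (prime∣^⇒∣ (length xs) r-1 pr r∣power)))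

    1≤c : ∀ n → 1 ≤ c n
    1≤c n with c n in c≡
    ... | suc _ = s≤s z≤n
    ... | zero  =
      ⊥-elim (r∤power (≡0-mod⇒∣ (≡-mod-sym (subst (λ k → + k ≡ + (length xs ^ r-1) [mod r ]) c≡ (c≡power n)))))

    ∑c≡length : ∑ allG c ≡ length allG
    ∑c≡length = begin
      ∑ allG c                                 ≡⟨ ∑-counts (map (r ·_) xs ⊗ ys) ⟩
      length (map (r ·_) xs ⊗ ys)              ≡⟨ length-⊗ (map (r ·_) xs) ys ⟩
      length (map (r ·_) xs) * length ys       ≡⟨ cong (_* length ys) (length-map (r ·_) xs) ⟩
      length xs * length ys                    ≡⟨ Tiles⇒length*length≡M T ⟩
      M                                        ≡⟨ length-allG ⟨
      length allG                              ∎
      where open ≡-Reasoning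

  tiles-dilate-product : ∀ {ps} → All Prime ps → NoCommonPrime (product ps) M →
                         ∀ {xs ys} → Tiles xs ys → Tiles (map (product ps ·_) xs) ys
  tiles-dilate-product {[]} [] _ {xs} {ys} T =
    subst (λ zs → Tiles zs ys) (sym (trans (map-cong ·-identityˡ xs) (map-id xs))) T
  tiles-dilate-product {p ∷ ps} (pp ∷ pps) coprime {xs} {ys} T =
    subst (λ zs → Tiles zs ys) (sym (trans (map-cong (λ x → sym (·-assoc p (product ps) x)) xs) (map-∘ xs)))
      (tiles-dilate-prime pp (coprime pp (m∣m*n (product ps)))
        (tiles-dilate-product pps (λ pr r∣ps → coprime pr (∣n⇒∣m*n p r∣ps)) T))

  tiles-dilate : ∀ u .{{_ : NonZero u}} → NoCommonPrime u M →
                 ∀ {xs ys} → Tiles xs ys → Tiles (map (u ·_) xs) ys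
  tiles-dilate u coprime {xs} {ys} =
    subst (λ v → Tiles (map (v ·_) xs) ys) (sym u≡∏)
    ∘ tiles-dilate-product (factorsPrime (factorise u)) (subst (λ v → NoCommonPrime v M) u≡∏ coprime)
    where u≡∏ = isFactorisation (factorise u)

  ≡-mod-shift : ∀ {d k} → d ∣ M → d ∣ k → ∀ x → toℤ x ≡ toℤ (x ⊕ k mod M) [mod d ]
  ≡-mod-shift {d} {k} d∣M d∣k x = begin
    toℤ x                  ≡⟨ ℤ.+-identityʳ (toℤ x) ⟨
    toℤ x ℤ.+ 0ℤ           ≈⟨ +-congˡ-mod (toℤ x) (∣⇒≡0-mod d∣k) ⟨
    toℤ x ℤ.+ + k          ≈⟨ ≡-mod-weaken d∣M (toℤ-⊕-mod x k) ⟨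
    toℤ (x ⊕ k mod M)      ∎
    where open ≡-mod-Reasoning d

  sums⇒differences : ∀ {d a₀ b₀ a b} → d ∣ M → toℤ (a₀ ⊕ b₀) ≡ toℤ (a ⊕ b) [mod d ] →
                     toℤ a ℤ.- toℤ a₀ ≡ toℤ b₀ ℤ.- toℤ b [mod d ]
  sums⇒differences {d} {a₀} {b₀} {a} {b} d∣M sums≡ = begin
    x ℤ.- x₀                               ≡⟨ regroup x y x₀ ⟩
    x ℤ.+ y ℤ.+ (ℤ.- x₀ ℤ.- y)             ≈⟨ +-congʳ-mod (ℤ.- x₀ ℤ.- y) sums≡' ⟨
    x₀ ℤ.+ y₀ ℤ.+ (ℤ.- x₀ ℤ.- y)           ≡⟨ regroup' x₀ y₀ y ⟨
    y₀ ℤ.- y                               ∎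
    where
    open ≡-mod-Reasoning d
    x₀ = toℤ a₀
    y₀ = toℤ b₀
    x = toℤ a
    y = toℤ b
    sums≡' : x₀ ℤ.+ y₀ ≡ x ℤ.+ y [mod d ]
    sums≡' = ≡-mod-trans (≡-mod-sym (≡-mod-weaken d∣M (toℤ-⊕ a₀ b₀)))
                         (≡-mod-trans sums≡ (≡-mod-weaken d∣M (toℤ-⊕ a b)))
    regroup : ∀ x y x₀ → x ℤ.- x₀ ≡ x ℤ.+ y ℤ.+ (ℤ.- x₀ ℤ.- y)
    regroup = solve-∀
    regroup' : ∀ x₀ y₀ y → y₀ ℤ.- y ≡ x₀ ℤ.+ y₀ ℤ.+ (ℤ.- x₀ ℤ.- y)
    regroup' = solve-∀

  -- q is invertible modulo P, so some t < P has t q ≡ k (mod P), whence t q D ≡ k D = x - x₀ - d (mod P D).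
  fibre-shift : ∀ {P q D} → Prime P → Prime q → P ≢ q → M ≡ P * q * D →
                ∀ a₀ {x d} → x ℤ.- toℤ a₀ ≡ d [mod D ] →
                Σ ℕ λ t → t < P × x ℤ.- toℤ (a₀ ⊕ (t * (q * D)) mod M) ≡ d [mod P * D ]
  fibre-shift {P} {q} {D} pP pq P≢q M≡PqD a₀ {x} {d} (mod-by (ℤ∣.divides k x-x₀-d≡kD)) =
    choose (linear-solvable-mod-prime pP (+ q) P∤q k)
    where
    x₀ = toℤ a₀

    P∤q : ¬ (+ P ∣ℤ + q)
    P∤q P∣q with prime⇒irreducible pq (ℤ∣.∣⇒∣ᵤ P∣q)
    ... | inj₁ P≡1 = ¬prime[1] (subst Prime P≡1 pP)
    ... | inj₂ P≡q = P≢q P≡q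

    PD∣M : P * D ∣ M
    PD∣M = divides q (trans M≡PqD (rearrange P q D))
      where
      rearrange : ∀ P q D → P * q * D ≡ q * (P * D)
      rearrange = Data.Nat.Tactic.RingSolver.solve-∀

    choose : (Σ ℕ λ t → t < P × + t ℤ.* + q ≡ k [mod P ]) →
             Σ ℕ λ t → t < P × x ℤ.- toℤ (a₀ ⊕ (t * (q * D)) mod M) ≡ d [mod P * D ]
    choose (t , t<P , tq≡k) = t , t<P , (begin
      x ℤ.- toℤ (a₀ ⊕ tqD mod M)    ≈⟨ +-congˡ-mod x (neg-cong-mod (≡-mod-weaken PD∣M (toℤ-⊕-mod a₀ tqD))) ⟩
      x ℤ.- (x₀ ℤ.+ + tqD)          ≈⟨ +-congˡ-mod x (neg-cong-mod (+-congˡ-mod x₀ tqD≡kD)) ⟩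
      x ℤ.- (x₀ ℤ.+ k ℤ.* + D)      ≡⟨ cancel x x₀ d (k ℤ.* + D) x-x₀-d≡kD ⟩
      d                             ∎)
      where
      open ≡-mod-Reasoning (P * D)
      tqD = t * (q * D)

      tqD≡kD : + tqD ≡ k ℤ.* + D [mod P * D ]
      tqD≡kD = subst₂ (λ i n → + tqD ≡ i [mod n ]) (ℤ.*-comm (+ D) k) (*-comm D P)
        (subst (_≡ + D ℤ.* k [mod D * P ]) (sym tqD≡D*tq) (*-scale-mod D tq≡k))
        where
        rearrange : ∀ t q D → t * (q * D) ≡ D * (t * q)
        rearrange = Data.Nat.Tactic.RingSolver.solve-∀
        tqD≡D*tq : + tqD ≡ + D ℤ.* (+ t ℤ.* + q)
        tqD≡D*tq = trans (cong +_ (rearrange t q D)) (trans (ℤ.pos-* D (t * q)) (cong (+ D ℤ.*_) (ℤ.pos-* t q)))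

      cancel : ∀ x x₀ d e → x ℤ.- x₀ ℤ.- d ≡ e → x ℤ.- (x₀ ℤ.+ e) ≡ d
      cancel x x₀ d e refl = expand x x₀ d
        where
        expand : ∀ x x₀ d → x ℤ.- (x₀ ℤ.+ (x ℤ.- x₀ ℤ.- d)) ≡ d
        expand = solve-∀

  module _ {S T : Subset M} (S? : Decidable S) (T? : Decidable T) where

    count-map-⊗-filter : ∀ (f : G → G) n →
      count n (map f (filter S? allG) ⊗ filter T? allG) ≡ ∑ allG (λ a → 𝟙 S? a * 𝟙 T? (n ⊖ f a))
    count-map-⊗-filter f n = begin
      count n (map f (filter S? allG) ⊗ filter T? allG)
        ≡⟨ count-⊗ n (map f (filter S? allG)) (filter T? allG) ⟩
      ∑ (map f (filter S? allG)) (λ x → count (n ⊖ x) (filter T? allG))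
        ≡⟨ ∑-map f (filter S? allG) _ ⟩
      ∑ (filter S? allG) (λ a → count (n ⊖ f a) (filter T? allG))
        ≡⟨ ∑-filter S? allG _ ⟩
      ∑ allG (λ a → 𝟙 S? a * count (n ⊖ f a) (filter T? allG))
        ≡⟨ ∑-cong (λ a → cong (𝟙 S? a *_) (count-filter-allFin T? (n ⊖ f a))) allG ⟩
      ∑ allG (λ a → 𝟙 S? a * 𝟙 T? (n ⊖ f a))  ∎
      where open ≡-Reasoning

    direct-sum⇒Tiles : DirectSumIsZM M S T → Tiles (filter S? allG) (filter T? allG)
    direct-sum⇒Tiles (decompose , unique) = tiles-by λ n → counts n (decompose n)
      where
      counts : ∀ n → (Σ G λ a₀ → Σ G λ b₀ → S a₀ × T b₀ × a₀ ⊕ b₀ ≡ n) →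
               count n (filter S? allG ⊗ filter T? allG) ≡ 1
      counts n (a₀ , b₀ , Sa₀ , Tb₀ , a₀+b₀≡n) = begin
        count n (filter S? allG ⊗ filter T? allG)
          ≡⟨ cong (λ xs → count n (xs ⊗ filter T? allG)) (map-id (filter S? allG)) ⟨
        count n (map id (filter S? allG) ⊗ filter T? allG)
          ≡⟨ count-map-⊗-filter id n ⟩
        ∑ allG (λ a → 𝟙 S? a * 𝟙 T? (n ⊖ a))
          ≡⟨ ∑-cong summand≡δ allG ⟩
        count a₀ allG
          ≡⟨ count-allFin a₀ ⟩
        1 ∎
        where
        open ≡-Reasoning
        summand≡δ : ∀ a → 𝟙 S? a * 𝟙 T? (n ⊖ a) ≡ δ a₀ a
        summand≡δ a with a₀ Fin.≟ a
        ... | yes refl =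
          cong₂ _*_ (𝟙-yes S? Sa₀) (𝟙-yes T? (subst T (⊕≡⇒≡⊖ {n} {a₀} {b₀} a₀+b₀≡n) Tb₀))
        ... | no  a₀≢a with S? a | T? (n ⊖ a)
        ...   | yes Sa | yes Tn⊖a = ⊥-elim (a₀≢a (sym (proj₁
                  (unique a a₀ (n ⊖ a) b₀ Sa Sa₀ Tn⊖a Tb₀ (trans (⊕-⊖-cancel n a) (sym a₀+b₀≡n))))))
        ...   | yes _  | no  _    = refl
        ...   | no  _  | _        = refl

    dilation-injective : DirectSumIsZM M S T → ∀ u .{{_ : NonZero u}} → NoCommonPrime u M →
                         ∀ {a a' b b'} → S a → S a' → T b → T b' → u · a ⊕ b ≡ u · a' ⊕ b' → a ≡ a'
    dilation-injective ds u coprime {a} {a'} {b} {b'} Sa Sa' Tb Tb' ua+b≡ua'+b' with a Fin.≟ a'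
    ... | yes a≡a' = a≡a'
    ... | no  a≢a' = ⊥-elim (<⇒≱ (s≤s (s≤s z≤n)) (begin
      2                                          ≡⟨ cong₂ _+_ (summand≡1 Sa Tb refl) (summand≡1 Sa' Tb' (sym ua+b≡ua'+b')) ⟨
      summand a + summand a'                     ≤⟨ two-terms≤∑ summand a≢a' ⟩
      ∑ allG summand                             ≡⟨ count-map-⊗-filter (u ·_) n₀ ⟨
      count n₀ (map (u ·_) (filter S? allG) ⊗ filter T? allG)
                                                 ≡⟨ counts-≡1 (tiles-dilate u coprime (direct-sum⇒Tiles ds)) n₀ ⟩
      1                                          ∎))
      where
      open ≤-Reasoning
      n₀ : G
      n₀ = u · a ⊕ b
      summand : G → ℕ
      summand x = 𝟙 S? x * 𝟙 T? (n₀ ⊖ u · x)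
      summand≡1 : ∀ {x y} → S x → T y → u · x ⊕ y ≡ n₀ → summand x ≡ 1
      summand≡1 {x} {y} Sx Ty ux+y≡n =
        cong₂ _*_ (𝟙-yes S? Sx) (𝟙-yes T? (subst T (⊕≡⇒≡⊖ {n₀} {u · x} {y} ux+y≡n) Ty))

    difference-in-power : DirectSumIsZM M S T → ∀ {q L N} → Prime q → M ≡ q * L → q ^ N ∣ L →
                          ∀ {a a' b b'} → S a → S a' → T b → T b' →
                          toℤ a ℤ.- toℤ a' ≡ toℤ b' ℤ.- toℤ b [mod L ] → toℤ a ≡ toℤ a' [mod q ^ N ]
    difference-in-power ds {q} {L} {N} pq M≡qL q^N∣L {a} {a'} {b} {b'} Sa Sa' Tb Tb' d≡d'
      with + (q ^ N) ℤ∣.∣? (toℤ a ℤ.- toℤ a')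
    ... | yes q^N∣d = mod-by q^N∣d
    -- Otherwise a multiplier u coprime to M gives u·a + b = u·a' + b', so a = a' by Tijdeman's theorem.
    ... | no  q^N∤d = ⊥-elim (not-exact (exact-power-below q (toℤ a ℤ.- toℤ a') N q^N∤d))
      where
      a≢a' : a ≢ a'
      a≢a' a≡a' = q^N∤d (∣-difference (≡-mod-reflexive {q ^ N} (cong toℤ a≡a')))

      multiplier-contradiction : (Σ ℕ λ u → NonZero u × NoCommonPrime u (q * L) ×
                                   + u ℤ.* (toℤ a ℤ.- toℤ a') ≡ toℤ b' ℤ.- toℤ b [mod q * L ]) → ⊥
      multiplier-contradiction (u , u≢0 , coprime , ud≡d') = a≢a' (dilation-injective ds u {{u≢0}}
        (subst (NoCommonPrime u) (sym M≡qL) coprime) Sa Sa' Tb Tb'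
        (scaled-difference⇒⊕≡ u (subst (+ u ℤ.* (toℤ a ℤ.- toℤ a') ≡ toℤ b' ℤ.- toℤ b [mod_]) (sym M≡qL) ud≡d')))

      not-exact : ¬ Σ ℕ λ s → s < N × (+ (q ^ s) ∣ℤ toℤ a ℤ.- toℤ a') × ¬ (+ (q ^ suc s) ∣ℤ toℤ a ℤ.- toℤ a')
      not-exact (s , s<N , q^s∣d , q^s+1∤d) = multiplier-contradiction
        (coprime-multiplier {s = s} pq (ℕ∣.∣-trans (^-∣-^ q s<N) q^N∣L) q^s∣d q^s+1∤d d≡d')

    fibre-lemma : DirectSumIsZM M S T → ∀ {P q N D} → Prime P → Prime q → P ≢ q →
                  M ≡ P * q * D → q ^ N ∣ D →
                  ∀ {a₀ b₀ a b} → S a₀ → T b₀ → S a → T b →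
                  toℤ (a₀ ⊕ b₀) ≡ toℤ (a ⊕ b) [mod D ] →
                  (∀ t → t < P → S (a₀ ⊕ (t * (q * D)) mod M)) →
                  toℤ a₀ ≡ toℤ a [mod q ^ N ]
    fibre-lemma ds {P} {q} {N} {D} pP pq P≢q M≡PqD q^N∣D {a₀} {b₀} {a} {b} Sa₀ Tb₀ Sa Tb sums≡ a₀+F⊆S =
      from-shift (fibre-shift pP pq P≢q M≡PqD a₀ {toℤ a} (sums⇒differences {D} {a₀} {b₀} {a} {b} D∣M sums≡))
      where
      D∣M : D ∣ M
      D∣M = subst (D ∣_) (sym M≡PqD) (n∣m*n (P * q))

      M≡q*PD : M ≡ q * (P * D)
      M≡q*PD = trans M≡PqD (rearrange P q D)
        where
        rearrange : ∀ P q D → P * q * D ≡ q * (P * D)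
        rearrange = Data.Nat.Tactic.RingSolver.solve-∀

      from-shift : (Σ ℕ λ t → t < P ×
                     toℤ a ℤ.- toℤ (a₀ ⊕ (t * (q * D)) mod M) ≡ toℤ b₀ ℤ.- toℤ b [mod P * D ]) →
                   toℤ a₀ ≡ toℤ a [mod q ^ N ]
      from-shift (t , t<P , a-a'≡b₀-b) = ≡-mod-trans
        (≡-mod-shift (ℕ∣.∣-trans q^N∣D D∣M) (ℕ∣.∣-trans q^N∣D (∣n⇒∣m*n t (n∣m*n q))) a₀)
        (≡-mod-sym (difference-in-power ds {N = N} pq M≡q*PD (ℕ∣.∣-trans q^N∣D (n∣m*n P))
                                        Sa (a₀+F⊆S t t<P) Tb Tb₀ a-a'≡b₀-b))

-- The modulus M = p_1^{n_1} ⋯ p_K^{n_K}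

primePowerProduct-factor : ∀ K (p n : Fin K → ℕ) k → p k ^ n k ∣ primePowerProduct K p n
primePowerProduct-factor (suc K) p n Fin.zero    = m∣m*n (primePowerProduct K (p ∘ Fin.suc) (n ∘ Fin.suc))
primePowerProduct-factor (suc K) p n (Fin.suc k) =
  ∣n⇒∣m*n (p Fin.zero ^ n Fin.zero) (primePowerProduct-factor K (p ∘ Fin.suc) (n ∘ Fin.suc) k)

primePowerProduct-factor-pair : ∀ K (p n : Fin K → ℕ) {i j} → i ≢ j →
                                p i ^ n i * p j ^ n j ∣ primePowerProduct K p n
primePowerProduct-factor-pair (suc K) p n {Fin.zero}  {Fin.zero}  0≢0 = ⊥-elim (0≢0 refl)
primePowerProduct-factor-pair (suc K) p n {Fin.zero}  {Fin.suc j} _   =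
  *-monoʳ-∣ (p Fin.zero ^ n Fin.zero) (primePowerProduct-factor K (p ∘ Fin.suc) (n ∘ Fin.suc) j)
primePowerProduct-factor-pair (suc K) p n {Fin.suc i} {Fin.zero}  _   =
  subst (_∣ primePowerProduct (suc K) p n) (*-comm (p Fin.zero ^ n Fin.zero) (p (Fin.suc i) ^ n (Fin.suc i)))
    (*-monoʳ-∣ (p Fin.zero ^ n Fin.zero) (primePowerProduct-factor K (p ∘ Fin.suc) (n ∘ Fin.suc) i))
primePowerProduct-factor-pair (suc K) p n {Fin.suc i} {Fin.suc j} i≢j =
  ∣n⇒∣m*n (p Fin.zero ^ n Fin.zero)
    (primePowerProduct-factor-pair K (p ∘ Fin.suc) (n ∘ Fin.suc) (i≢j ∘ cong Fin.suc))

split-modulus : ∀ {M P q a b} → 1 ≤ a → 1 ≤ b → P ^ a * q ^ b ∣ M →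
                Σ ℕ λ R → M ≡ P * q * (q ^ (b ∸ 1) * R)
split-modulus {P = P} {q} {suc a} {suc b} _ _ (divides c M≡c*PᵃqᵇP) =
  P ^ a * c , trans M≡c*PᵃqᵇP (rearrange c P (P ^ a) q (q ^ b))
  where
  rearrange : ∀ c P Pᵃ q qᵇ → c * (P * Pᵃ * (q * qᵇ)) ≡ P * q * (qᵇ * (Pᵃ * c))
  rearrange = Data.Nat.Tactic.RingSolver.solve-∀

primePowerProduct-split : ∀ K (p n : Fin K → ℕ) → (∀ k → n k ≥ 1) → ∀ {i j} → i ≢ j →
                          Σ ℕ λ R → primePowerProduct K p n ≡ p i * p j * (p j ^ (n j ∸ 1) * R)
primePowerProduct-split K p n n≥1 {i} {j} i≢j =
  split-modulus (n≥1 i) (n≥1 j) (primePowerProduct-factor-pair K p n i≢j)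

quot2-≡ : ∀ {M P q D} (pP : Prime P) (pq : Prime q) → M ≡ P * q * D → quot2 M P q pP pq ≡ D
quot2-≡ {M} {P} {q} {D} pP pq M≡PqD =
  trans (cong (_/ (P * q)) (trans M≡PqD (*-comm (P * q) D))) (m*n/n≡m D (P * q))
  where instance _ = m*n≢0 P q {{prime⇒nonZero pP}} {{prime⇒nonZero pq}}

/-first-factor : ∀ {M P q D} .{{_ : NonZero P}} → M ≡ P * q * D → M / P ≡ q * D
/-first-factor {M} {P} {q} {D} M≡PqD = trans (cong (_/ P) (trans M≡PqD (rearrange P q D))) (m*n/n≡m (q * D) P)
  where
  rearrange : ∀ P q D → P * q * D ≡ q * D * P
  rearrange = Data.Nat.Tactic.RingSolver.solve-∀

¬¬-decidable : ∀ n (P : Fin n → Set) → ¬ ¬ Decidable P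
¬¬-decidable zero    P ¬dec = ¬dec λ ()
¬¬-decidable (suc n) P ¬dec = ¬¬-excluded-middle λ P0? → ¬¬-decidable n (P ∘ Fin.suc) λ Psuc? →
  ¬dec λ { Fin.zero → P0? ; (Fin.suc x) → Psuc? x }

lemma11p3 :
    (K : ℕ) (p n : Fin K → ℕ) →
    (pp : (k : Fin K) → Prime (p k)) →
    ((k l : Fin K) → p k ≡ p l → k ≡ l) →
    ((k : Fin K) → n k ≥ 1) →
    (M : ℕ) → .{{_ : NonZero M}} → M ≡ primePowerProduct K p n →
    (A B : Subset M) → DirectSumIsZM M A B →
    (z : Fin M) (i j : Fin K) → i ≢ j →
    (a₀ : Fin M) →
    ΣA M A B (Λ M z (quot2 M (p i) (p j) (pp i) (pp j))) a₀ →
    TranslateSubset a₀ (F M (p i) (pp i)) A →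
    (a : Fin M) →
    ΣA M A B (Λ M z (quot2 M (p i) (p j) (pp i) (pp j))) a →
    Π M a₀ (p j) (n j ∸ 1) a
lemma11p3 K p n pp injective n≥1 M M≡∏ A B ds z i j i≢j a₀ (Aa₀ , b₀ , Bb₀ , Λz[a₀+b₀]) a₀+Fᵢ⊆A
          a (Aa , b , Bb , Λz[a+b]) =
  -- The goal is decidable, so we may assume that A and B are decidable.
  ℤ∣.∣⇒∣ᵤ (decidable-stable (+ (p j ^ N) ℤ∣.∣? (toℤ a₀ ℤ.- toℤ a)) λ ¬goal →
    ¬¬-decidable M A λ A? → ¬¬-decidable M B λ B? →
      ¬goal (∣-difference (fibre-lemma A? B? ds {N = N} (pp i) (pp j) (i≢j ∘ injective i j) M≡pᵢpⱼD (m∣m*n R)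
               Aa₀ Bb₀ Aa Bb (≡-mod-trans (≡-mod-sym (Λ⇒≡-mod Λz[a₀+b₀])) (Λ⇒≡-mod Λz[a+b])) fibre)))
  where
  open ℤMod M
  instance _ = prime⇒nonZero (pp i)
  N = n j ∸ 1
  R = proj₁ (primePowerProduct-split K p n n≥1 i≢j)
  M≡pᵢpⱼD : M ≡ p i * p j * (p j ^ N * R)
  M≡pᵢpⱼD = trans M≡∏ (proj₂ (primePowerProduct-split K p n n≥1 i≢j))

  Λ⇒≡-mod : ∀ {x} → Λ M z (quot2 M (p i) (p j) (pp i) (pp j)) x → toℤ z ≡ toℤ x [mod p j ^ N * R ]
  Λ⇒≡-mod {x} Λzx = mod-by (ℤ∣.∣ᵤ⇒∣ (subst (λ d → Λ M z d x) (quot2-≡ (pp i) (pp j) M≡pᵢpⱼD) Λzx))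

  fibre : ∀ t → t < p i → A (a₀ ⊕ (t * (p j * (p j ^ N * R))) mod M)
  fibre t t<pᵢ = a₀+Fᵢ⊆A _ (t , t<pᵢ , cong (λ v → (t * v) mod M) (sym (/-first-factor {P = p i} {p j} M≡pᵢpⱼD)))
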